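{- Let $G$ be a simple graph with vertex set $[d]$, where $d\ge3$, and let $\Delta_G$ be its (truncated) coloring complex. (1) For each edge $e=\{i,j\}$ of $G$, the $(d-1)!$ $e$-permutations give exactly $(d-1)!$ distinct facets of $\Delta_G$, and the facets so obtained, over all edges of $G$, are all the facets of $\Delta_G$; the sets of facets corresponding to two distinct edges are disjoint. The facets corresponding to one edge form a $(d-3)$-sphere (the edge-sphere of $e$), isomorphic to the order complex of the truncated Boolean algebra on $d-1$ elements, i.e. to the first barycentric subdivision of the boundary of a $(d-2)$-simplex. In particular $\Delta_G$ has dimension $d-3$, unless $G$ has no edges, in which case $\Delta_G$ is the empty complex (it has no faces). (2) Any two distinct edge-spheres intersect in a $(d-4)$-sphere isomorphic to the order complex of the truncated Boolean algebra on $d-2$ elements. Moreover, if $e$ and $f=\{i,j\}$ are two distinct edges, then the intersection of their edge-spheres separates the $e$-sphere into two halves, one of which contains all vertices of the $e$-sphere that contain $i$ and not $j$, while the other contains those vertices that contain $j$ and not $i$.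
   Context: $G$ is a simple graph with vertex set $[d]$. For $\pi=a_1\cdots a_d\in\mathcal S_d$ and $k\in[d]$, $\ell(k)$ is the largest $r\ge0$ such that there are indices $i_0<\cdots<i_r=k$ with $a_{i_{s-1}}$ adjacent to $a_{i_s}$ in $G$ for all $s$. An integer $k\in\{0,\dots,d-1\}$ is a cut of $\pi$ if $k=0$, or $\ell(k)<\ell(k+1)$, or $\ell(k)=\ell(k+1)$ and $a_k<a_{k+1}$. If the cuts are $0=i_1<\cdots<i_q$, the $G$-sequence of $\pi$ is $S_1,\dots,S_q$ with $S_j=\{a_{i_j+1},\dots,a_{i_{j+1}}\}$ for $j<q$ and $S_q=\{a_{i_q+1},\dots,a_d\}$; the short $G$-sequence is $S_1,\dots,S_{q-1}$. A basic chain is a chain $\emptyset\subsetneq S_1\subsetneq\cdots\subsetneq S_k\subsetneq[d]$ ($k\ge0$) such that some $\pi\in\mathcal S_d$ has short $G$-sequence $S_1,S_2\setminus S_1,\dots,S_k\setminus S_{k-1}$. The truncated Boolean algebra $\hat B_d$ is the poset of nonempty proper subsets of $[d]$; its order complex has as faces the chains in $\hat B_d$. The (truncated) coloring complex $\Delta_G$ is the subcomplex of the order complex of $\hat B_d$ whose faces are the chains of nonempty proper subsets of $[d]$ that contain no basic chain as a subset (equivalently, its face ring is the face ring of the order complex of $\hat B_d$ modulo the ideal generated by the monomials $x_{S_1}\cdots x_{S_k}$ of basic chains). For an edge $e=\{i,j\}$ of $G$, an $e$-permutation is a permutation $b_1b_2\cdots b_{d-1}$ of the set $([d]\setminus\{i,j\})\cup\{e\}$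 (so $e$ is treated as a single letter); the facet corresponding to it is $\{T_1,\dots,T_{d-2}\}$ where $T_m$ is the union of $b_1,\dots,b_m$, with the letter $e$ contributing the two elements $i,j$. (E.g. for $e=\{2,5\}$, $d=5$, the $e$-permutation $3,e,1,4$ gives the facet $\{\{3\},\{2,3,5\},\{1,2,3,5\}\}$.) -}

module Defs where

open import Data.Bool using (Bool; true; false; if_then_else_)
open import Data.Nat as ℕ using (ℕ; zero; suc; _∸_; _≤ᵇ_; _<ᵇ_)
open import Data.Fin as Fin using (Fin; toℕ; _≟_)
open import Data.Fin.Subset as Sub using (Subset; ⁅_⁆; _∪_; _─_; Nonempty)
open import Data.Fin.Permutation using (Permutation′; _⟨$⟩ʳ_)
open import Data.List as List using (List; []; _∷_; [_]; map; foldr; take; length)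
open import Data.List.Base using (filterᵇ)
open import Data.List.Membership.Propositional as LMem using ()
open import Data.List.Relation.Unary.All using (All)
open import Data.List.Relation.Unary.AllPairs using (AllPairs)
open import Data.List.Relation.Unary.Linked using (Linked)
open import Data.List.Relation.Binary.Permutation.Propositional using (_↭_)
open import Data.Vec.Base using (allFin)
open import Data.Product using (Σ; ∃; _×_; _,_)
open import Data.Sum using (_⊎_)
open import Relation.Nullary using (¬_; does)
open import Relation.Binary.PropositionalEquality using (_≡_)
open import Relation.Binary.Construct.Closure.ReflexiveTransitive using (Star)

record SimpleGraph (d : ℕ) : Set where
  field
    adj    : Fin d → Fin d → Bool
    sym    : ∀ i j → adj i j ≡ adj j i
    irrefl : ∀ i → adj i i ≡ false
open SimpleGraph public

-- An edge {i , j} of G, stored with i < j (so each edge has one representation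
-- up to the proof components).
record Edge {d : ℕ} (G : SimpleGraph d) : Set where
  constructor edge
  field
    ei  : Fin d
    ej  : Fin d
    lt  : ei Fin.< ej
    isE : adj G ei ej ≡ true
open Edge public

SameEdge : ∀ {d} {G : SimpleGraph d} → Edge G → Edge G → Set
SameEdge e f = (ei e ≡ ei f) × (ej e ≡ ej f)

-- Finite sets of vertices (faces) represented by lists, with set semantics

_∈ˡ_ : ∀ {A : Set} → A → List A → Set
x ∈ˡ xs = x LMem.∈ xs

_⊆ˡ_ : ∀ {A : Set} → List A → List A → Set
xs ⊆ˡ ys = All (_∈ˡ ys) xs

_≋_ : ∀ {A : Set} → List A → List A → Set
xs ≋ ys = (xs ⊆ˡ ys) × (ys ⊆ˡ xs)

Proper : ∀ {n} → Subset n → Set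
Proper {n} S = ∃ λ x → x Sub.∉ S

InBhat : ∀ {n} → Subset n → Set
InBhat S = Nonempty S × Proper S

Comparable : ∀ {n} → Subset n → Subset n → Set
Comparable S T = (S Sub.⊆ T) ⊎ (T Sub.⊆ S)

OCFace : (n : ℕ) → List (Subset n) → Set
OCFace n σ = All InBhat σ × AllPairs Comparable σ

-- Longest G-paths ℓ(k), cuts, G-sequences (positions are 0-based: position
-- p : Fin d corresponds to the paper's index p+1)

module _ {d : ℕ} (G : SimpleGraph d) (π : Permutation′ d) where

  letter : Fin d → Fin d
  letter p = π ⟨$⟩ʳ p

  data HasPath : Fin d → ℕ → Set where
    here : ∀ k → HasPath k 0
    step : ∀ {i k r} → i Fin.< k → adj G (letter i) (letter k) ≡ true →
           HasPath i r → HasPath k (suc r)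

  Longest : Fin d → ℕ → Set
  Longest k r = HasPath k r × (∀ r′ → HasPath k r′ → r′ ℕ.≤ r)

  -- Cut k (k ∈ {0,…,d-1}); for k = suc m the paper's positions k, k+1 are
  -- the 0-based positions p, q with toℕ p = m, toℕ q = m+1.
  data Cut : ℕ → Set where
    cut0  : Cut 0
    cutLt : (p q : Fin d) → toℕ q ≡ suc (toℕ p) → ∀ r r′ →
            Longest p r → Longest q r′ → r ℕ.< r′ → Cut (suc (toℕ p))
    cutEq : (p q : Fin d) → toℕ q ≡ suc (toℕ p) → ∀ r →
            Longest p r → Longest q r → letter p Fin.< letter q → Cut (suc (toℕ p))

  IsCutList : List ℕ → Set
  IsCutList cs = (∃ λ rest → cs ≡ 0 ∷ rest) × Linked ℕ._<_ cs
               × (∀ k → Cut k → k ∈ˡ cs) × All Cut cs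

  -- block {a_{lo+1}, …, a_{hi}} (paper's 1-based indices), i.e. 0-based
  -- positions p with lo ≤ p < hi
  block : ℕ → ℕ → Subset d
  block lo hi = foldr _∪_ Sub.⊥
    (map (λ p → ⁅ letter p ⁆)
      (filterᵇ (λ p → (lo ≤ᵇ toℕ p) Data.Bool.∧ (toℕ p <ᵇ hi)) (List.allFin d)))

  shortGSeq : List ℕ → List (Subset d)
  shortGSeq (c ∷ c′ ∷ cs) = block c c′ ∷ shortGSeq (c′ ∷ cs)
  shortGSeq _ = []

diffsFrom : ∀ {d} → Subset d → List (Subset d) → List (Subset d)
diffsFrom prev [] = []
diffsFrom prev (S ∷ Ss) = (S ─ prev) ∷ diffsFrom S Ss

diffs : ∀ {d} → List (Subset d) → List (Subset d)
diffs = diffsFrom Sub.⊥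

BasicChain : ∀ {d} → SimpleGraph d → List (Subset d) → Set
BasicChain {d} G B =
  Linked Sub._⊂_ B × All InBhat B ×
  Σ (Permutation′ d) λ π → Σ (List ℕ) λ cs →
    IsCutList G π cs × diffs B ≡ shortGSeq G π cs

Face : ∀ {d} → SimpleGraph d → List (Subset d) → Set
Face {d} G σ = OCFace d σ × (∀ B → BasicChain G B → ¬ (B ⊆ˡ σ))

IsFacet : ∀ {d} → SimpleGraph d → List (Subset d) → Set
IsFacet G σ = Face G σ × (∀ τ → Face G τ → σ ⊆ˡ τ → τ ⊆ˡ σ)

-- the letters ([d] ∖ {i,j}) ∪ {e}, each as a subset of [d]
letters : ∀ {d} {G : SimpleGraph d} → Edge G → List (Subset d)
letters {d} e = map toSet (filterᵇ (λ x → Data.Bool.not (does (x ≟ ej e))) (List.allFin d))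
  where
  toSet : Fin d → Subset d
  toSet x = if does (x ≟ ei e) then ⁅ ei e ⁆ ∪ ⁅ ej e ⁆ else ⁅ x ⁆

EPerm : ∀ {d} {G : SimpleGraph d} → Edge G → List (Subset d) → Set
EPerm e b = b ↭ letters e

prefixUnions : ∀ {d} → Subset d → List (Subset d) → List (Subset d)
prefixUnions acc [] = []
prefixUnions acc (x ∷ xs) = (acc ∪ x) ∷ prefixUnions (acc ∪ x) xs

facetOf : ∀ {d} → List (Subset d) → List (Subset d)
facetOf {d} b = take (d ∸ 2) (prefixUnions Sub.⊥ b)

InSphere : ∀ {d} {G : SimpleGraph d} → Edge G → List (Subset d) → Set
InSphere e σ = ∃ λ b → EPerm e b × σ ⊆ˡ facetOf b

-- Isomorphism of simplicial complexes given by face predicates on lists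
-- (lists read as finite vertex sets; vertices = v with [ v ] a face)

record SimplicialIso {V W : Set} (K : List V → Set) (L : List W → Set) : Set where
  field
    to        : V → W
    from      : W → V
    from-to   : ∀ v → K [ v ] → from (to v) ≡ v
    to-from   : ∀ w → L [ w ] → to (from w) ≡ w
    to-face   : ∀ σ → K σ → L (map to σ)
    from-face : ∀ τ → L τ → K (map from τ)

-- dimension of Δ_G is d-3 : the maximal number of distinct vertices of a face is d-2
HasDimension : ∀ {d} → SimpleGraph d → ℕ → Set
HasDimension {d} G n =
  (∃ λ σ → Face G σ × AllPairs (λ x y → ¬ x ≡ y) σ × length σ ≡ suc n)
  × (∀ σ → Face G σ → AllPairs (λ x y → ¬ x ≡ y) σ → length σ ℕ.≤ suc n)

Part1 : ∀ {d} → SimpleGraph d → Set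
Part1 {d} G =
  (∀ (e : Edge G) →
      (∀ b → EPerm e b → IsFacet G (facetOf b))
    × (∀ b b′ → EPerm e b → EPerm e b′ → facetOf b ≋ facetOf b′ → b ≡ b′))
  × (∀ σ → IsFacet G σ → Σ (Edge G) λ e → ∃ λ b → EPerm e b × σ ≋ facetOf b)
  × (∀ (e f : Edge G) b b′ → EPerm e b → EPerm f b′ → facetOf b ≋ facetOf b′ → SameEdge e f)
  × (∀ (e : Edge G) → SimplicialIso (InSphere e) (OCFace (d ∸ 1)))
  × (Edge G → HasDimension G (d ∸ 3))
  × (¬ Edge G → ∀ σ → ¬ Face G σ)

module Separation {d : ℕ} {G : SimpleGraph d} (e f : Edge G) where

  Outside : List (Subset d) → Set
  Outside σ = InSphere e σ × ¬ InSphere f σ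

  -- open simplices σ, τ of |S_e| ∖ |S_e ∩ S_f| touch iff one is a face of the other
  Touch : List (Subset d) → List (Subset d) → Set
  Touch σ τ = Outside σ × Outside τ × ((σ ⊆ˡ τ) ⊎ (τ ⊆ˡ σ))

  Connected : List (Subset d) → List (Subset d) → Set
  Connected = Star Touch

  SideI SideJ : Subset d → Set
  SideI v = InSphere e [ v ] × ei f Sub.∈ v × ej f Sub.∉ v
  SideJ v = InSphere e [ v ] × ej f Sub.∈ v × ei f Sub.∉ v

  Separates : Set
  Separates =
      (∃ SideI) × (∃ SideJ)
    × (∀ v v′ → SideI v → SideI v′ → Connected [ v ] [ v′ ])
    × (∀ w w′ → SideJ w → SideJ w′ → Connected [ w ] [ w′ ])
    × (∀ v w → SideI v → SideJ w → ¬ Connected [ v ] [ w ])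
    × (∀ σ → Outside σ →
         (∃ λ v → SideI v × Connected σ [ v ]) ⊎ (∃ λ w → SideJ w × Connected σ [ w ]))

Part2 : ∀ {d} → SimpleGraph d → Set
Part2 {d} G =
  ∀ (e f : Edge G) → ¬ SameEdge e f →
      SimplicialIso (λ σ → InSphere e σ × InSphere f σ) (OCFace (d ∸ 2))
    × Separation.Separates e f

-- A chain σ of nonempty proper subsets of [d] is a face of Δ_G exactly when some edge {i, j} of G
-- is split by no member of σ (no member contains exactly one of i, j). Every basic chain splits
-- every edge: the longest-path length ℓ increases along an edge, which forces a cut between its
-- endpoints. Conversely, if σ splits every edge, list the vertices by depth (the number of
-- members of σ missing them), breaking ties by decreasing length of the longest depth-increasing
-- path of G ending there and then by decreasing label; the cuts of this permutation are exactly
-- the rises in depth, so its basic chain lies in σ.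
--
-- For an edge e = {a, b}, the chains of sets not splitting e are exactly the subchains of the
-- facets of e-permutations, the letters being sorted by how many members of the chain miss them.
-- These are the chains of subsets of [d] with a and b identified, which gives the isomorphism with
-- the order complex of the truncated Boolean algebra on d - 1 elements; identifying also the ends
-- of a second edge f gives the intersection of two edge-spheres. Outside the f-sphere every
-- simplex of the e-sphere has a member splitting f = {i, j}, and having a member that contains i
-- but not j is invariant along paths there, which separates the two halves.

module Submission where

open import Defs hiding (sym)
open import Data.Bool as Bool using (Bool; true; not; T; T?; _∧_; if_then_else_)
open import Data.Bool.Properties using (T-∧)
open import Data.Empty using (⊥-elim)
open import Data.Fin as Fin using (Fin; toℕ; fromℕ<; punchIn; punchOut)
open import Data.Fin.Properties as Finₚ using (toℕ-injective; toℕ<n; toℕ-fromℕ<; fromℕ<-toℕ; any?)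
open import Data.Fin.Permutation using (Permutation′; permutation; _⟨$⟩ˡ_; inverseˡ; inverseʳ)
open import Data.Fin.Subset as Sub using (Subset; _∈_; _∉_; _⊆_; _⊂_; _∪_; _∩_; _─_; ⁅_⁆; ⋃; Nonempty; ∣_∣; inside; outside)
open import Data.Fin.Subset.Properties as Subₚ using (_∈?_; _⊆?_; ⊆-antisym; ⊆-trans; ⊆-min; p⊆p∪q; q⊆p∪q; x∈p∪q⁺; x∈p∪q⁻; x∈p∩q⁺; x∈p∩q⁻; x∈⁅x⁆; x∈⁅y⁆⇒x≡y; ∉⊥; p─q⊆p; x∈p∧x∉q⇒x∈p─q; p∩q⊆p; p∩q⊆q; drop-there)
open import Data.List as List using (List; []; _∷_; [_]; length; map; filter; filterᵇ; upTo; applyUpTo)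
import Data.List.Properties as Listₚ
open import Data.List.Relation.Unary.All as All using (All; []; _∷_; all?)
import Data.List.Relation.Unary.All.Properties as Allₚ
import Data.List.Relation.Unary.Any.Properties as Anyₚ
open import Data.List.Relation.Unary.Any as Any using (Any; here; there)
open import Data.List.Relation.Unary.AllPairs as AllPairs using (AllPairs; []; _∷_)
import Data.List.Relation.Unary.AllPairs.Properties as AllPairsₚ
open import Data.List.Relation.Unary.Linked as Linked using (Linked; []; [-]; _∷_)
open import Data.List.Relation.Unary.Linked.Properties using (AllPairs⇒Linked; Linked⇒AllPairs)
open import Data.List.Relation.Unary.Unique.Propositional using (Unique)
open import Data.List.Relation.Unary.Unique.Propositional.Properties using () renaming (allFin⁺ to Unique-allFin)
open import Data.List.Membership.Propositional using (find; lose)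
import Data.List.Membership.Propositional.Properties as Memₚ
open import Data.List.Relation.Binary.Permutation.Propositional using (_↭_; ↭-refl; ↭-sym; ↭⇒↭ₛ)
import Data.List.Relation.Binary.Permutation.Setoid.Properties as ↭ₛ
open import Data.List.Relation.Binary.Permutation.Propositional.Properties using (All-resp-↭; Any-resp-↭; ↭-length)
open import Data.List.Extrema.Nat using (max; xs≤max; argmax-sel)
open import Data.Nat as ℕ using (ℕ; zero; suc; _≤_; _<_; _∸_; z≤n; s≤s)
import Data.Nat.Properties as ℕₚ
open import Data.Product as Product using (Σ; ∃; _×_; _,_; proj₁; proj₂)
open import Data.Sum as Sum using (_⊎_; inj₁; inj₂; [_,_]′)
open import Data.Vec.Base using ([]; _∷_; here; there; tabulate; lookup)
import Data.Vec.Properties as Vecₚ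
open import Function using (_∘_; id; const; Equivalence)
open import Relation.Nullary using (¬_; Dec; yes; no; does; ¬?; contradiction)
open import Relation.Nullary.Decidable using (_×-dec_; _⊎-dec_; dec-true; decidable-stable)
open import Relation.Unary using (Decidable)
import Relation.Binary.Construct.On as On
import Data.List.Sort as Sort
open import Relation.Binary.Definitions using (tri<; tri≈; tri>)
open import Relation.Binary.Construct.Closure.ReflexiveTransitive using (ε; _◅_)
open import Relation.Binary.PropositionalEquality using (_≡_; _≢_; setoid; resp₂; refl; sym; trans; cong; cong₂; subst; subst₂; module ≡-Reasoning)

private
  variable
    A : Set
    n m : ℕ

Unsplit : Subset n → Fin n → Fin n → Set
Unsplit S x y = (x ∈ S → y ∈ S) × (y ∈ S → x ∈ S)

Splits : Subset n → Fin n → Fin n → Set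
Splits S x y = (x ∈ S × y ∉ S) ⊎ (y ∈ S × x ∉ S)

Disjoint : Subset n → Subset n → Set
Disjoint S T = ∀ x → x ∈ S → x ∉ T

unsplit⊎splits : (S : Subset n) (x y : Fin n) → Unsplit S x y ⊎ Splits S x y
unsplit⊎splits S x y with x ∈? S | y ∈? S
... | yes x∈S | yes y∈S = inj₁ (const y∈S , const x∈S)
... | no  x∉S | no  y∉S = inj₁ ((λ x∈S → contradiction x∈S x∉S) , (λ y∈S → contradiction y∈S y∉S))
... | yes x∈S | no  y∉S = inj₂ (inj₁ (x∈S , y∉S))
... | no  x∉S | yes y∈S = inj₂ (inj₂ (y∈S , x∉S))

unsplit⇒¬splits : {S : Subset n} {x y : Fin n} → Unsplit S x y → ¬ Splits S x y
unsplit⇒¬splits (x⇒y , _) (inj₁ (x∈S , y∉S)) = y∉S (x⇒y x∈S)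
unsplit⇒¬splits (_ , y⇒x) (inj₂ (y∈S , x∉S)) = x∉S (y⇒x y∈S)

¬unsplit⇒splits : {S : Subset n} {x y : Fin n} → ¬ Unsplit S x y → Splits S x y
¬unsplit⇒splits {S = S} {x} {y} ¬u with unsplit⊎splits S x y
... | inj₁ u = contradiction u ¬u
... | inj₂ s = s

unsplit? : (S : Subset n) (x y : Fin n) → Dec (Unsplit S x y)
unsplit? S x y with unsplit⊎splits S x y
... | inj₁ u = yes u
... | inj₂ s = no (λ u → unsplit⇒¬splits u s)

splits-sym : {S : Subset n} {x y : Fin n} → Splits S x y → Splits S y x
splits-sym (inj₁ s) = inj₂ s
splits-sym (inj₂ s) = inj₁ s

∪-unsplit : (S T : Subset n) {x y : Fin n} → Unsplit S x y → Unsplit T x y → Unsplit (S ∪ T) x y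
∪-unsplit S T (x⇒y , y⇒x) (x⇒y′ , y⇒x′) =
  [ x∈p∪q⁺ ∘ inj₁ ∘ x⇒y , x∈p∪q⁺ ∘ inj₂ ∘ x⇒y′ ]′ ∘ x∈p∪q⁻ S T ,
  [ x∈p∪q⁺ ∘ inj₁ ∘ y⇒x , x∈p∪q⁺ ∘ inj₂ ∘ y⇒x′ ]′ ∘ x∈p∪q⁻ S T

∩-unsplit : (S T : Subset n) {x y : Fin n} → Unsplit S x y → Unsplit T x y → Unsplit (S ∩ T) x y
∩-unsplit S T (x⇒y , y⇒x) (x⇒y′ , y⇒x′) =
  (λ x∈ → let x∈S , x∈T = x∈p∩q⁻ S T x∈ in x∈p∩q⁺ (x⇒y x∈S , x⇒y′ x∈T)) ,
  (λ y∈ → let y∈S , y∈T = x∈p∩q⁻ S T y∈ in x∈p∩q⁺ (y⇒x y∈S , y⇒x′ y∈T))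

∪-disjoint : {S T U : Subset n} → Disjoint S U → Disjoint T U → Disjoint (S ∪ T) U
∪-disjoint {S = S} {T} S#U T#U x x∈S∪T = [ S#U x , T#U x ]′ (x∈p∪q⁻ S T x∈S∪T)

x∈p─q⇒x∉q : (p q : Subset n) {x : Fin n} → x ∈ p ─ q → x ∉ q
x∈p─q⇒x∉q (_ ∷ p) (outside ∷ q) here ()
x∈p─q⇒x∉q (_ ∷ p) (_ ∷ q) (there x∈p─q) (there x∈q) = x∈p─q⇒x∉q p q x∈p─q x∈q

─-cancelʳ : {S T U : Subset n} → U ⊆ S → U ⊆ T → S ─ U ≡ T ─ U → S ≡ T
─-cancelʳ {S = S} {T} {U} U⊆S U⊆T eq = ⊆-antisym (incl U⊆T eq) (incl U⊆S (sym eq))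
  where
  incl : {S T : Subset _} → U ⊆ T → S ─ U ≡ T ─ U → S ⊆ T
  incl {S} {T} U⊆T eq {x} x∈S with x ∈? U
  ... | yes x∈U = U⊆T x∈U
  ... | no  x∉U = p─q⊆p T U (subst (x ∈_) eq (x∈p∧x∉q⇒x∈p─q x∈S x∉U))

⊆⊎witness : (S T : Subset n) → S ⊆ T ⊎ ∃ λ x → x ∈ S × x ∉ T
⊆⊎witness []      []      = inj₁ (λ ())
⊆⊎witness (s ∷ S) (t ∷ T) with ⊆⊎witness S T
... | inj₂ (x , x∈S , x∉T) = inj₂ (Fin.suc x , there x∈S , x∉T ∘ drop-there)
⊆⊎witness (outside ∷ S) (t ∷ T)       | inj₁ S⊆T = inj₁ λ { (there x∈S) → there (S⊆T x∈S) }
⊆⊎witness (inside ∷ S)  (inside ∷ T)  | inj₁ S⊆T = inj₁ λ { here → here ; (there x∈S) → there (S⊆T x∈S) }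
⊆⊎witness (inside ∷ S)  (outside ∷ T) | inj₁ _   = inj₂ (Fin.zero , here , λ ())

∈-⋃⁻ : (Ls : List (Subset n)) {x : Fin n} → x ∈ ⋃ Ls → Any (x ∈_) Ls
∈-⋃⁻ []       x∈ = contradiction x∈ ∉⊥
∈-⋃⁻ (L ∷ Ls) x∈ = [ here , there ∘ ∈-⋃⁻ Ls ]′ (x∈p∪q⁻ L (⋃ Ls) x∈)

∈-⋃⁺ : (Ls : List (Subset n)) {x : Fin n} → Any (x ∈_) Ls → x ∈ ⋃ Ls
∈-⋃⁺ (L ∷ Ls) (here x∈L)   = x∈p∪q⁺ (inj₁ x∈L)
∈-⋃⁺ (L ∷ Ls) (there x∈Ls) = x∈p∪q⁺ (inj₂ (∈-⋃⁺ Ls x∈Ls))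

∈-tabulate⁻ : (f : Fin n → Bool) {x : Fin n} → x ∈ tabulate f → f x ≡ true
∈-tabulate⁻ f {x} x∈ = trans (sym (Vecₚ.lookup∘tabulate f x)) (Vecₚ.[]=⇒lookup x∈)

∈-tabulate⁺ : (f : Fin n → Bool) {x : Fin n} → f x ≡ true → x ∈ tabulate f
∈-tabulate⁺ f {x} fx = Vecₚ.lookup⇒[]= x (tabulate f) (trans (Vecₚ.lookup∘tabulate f x) fx)

preimage : (Fin n → Fin m) → Subset m → Subset n
preimage f W = tabulate (λ x → lookup W (f x))

∈-preimage⁻ : (f : Fin n → Fin m) (W : Subset m) {x : Fin n} → x ∈ preimage f W → f x ∈ W
∈-preimage⁻ f W {x} x∈ = Vecₚ.lookup⇒[]= (f x) W (∈-tabulate⁻ (λ x → lookup W (f x)) x∈)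

∈-preimage⁺ : (f : Fin n → Fin m) (W : Subset m) {x : Fin n} → f x ∈ W → x ∈ preimage f W
∈-preimage⁺ f W {x} fx∈ = ∈-tabulate⁺ (λ x → lookup W (f x)) (Vecₚ.[]=⇒lookup fx∈)

preimage-⊆ : (f : Fin n → Fin m) {S T : Subset m} → S ⊆ T → preimage f S ⊆ preimage f T
preimage-⊆ f {S} {T} S⊆T x∈ = ∈-preimage⁺ f T (S⊆T (∈-preimage⁻ f S x∈))

comparable-preimage : (f : Fin n → Fin m) {S T : Subset m} →
                      Comparable S T → Comparable (preimage f S) (preimage f T)
comparable-preimage f (inj₁ S⊆T) = inj₁ (preimage-⊆ f S⊆T)
comparable-preimage f (inj₂ T⊆S) = inj₂ (preimage-⊆ f T⊆S)

comparable-∈ : {σ : List (Subset n)} → AllPairs Comparable σ →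
               ∀ {S T} → S ∈ˡ σ → T ∈ˡ σ → Comparable S T
comparable-∈ (_ ∷ _)   (here refl) (here refl) = inj₁ id
comparable-∈ (S≷ ∷ _)  (here refl) (there T∈) = All.lookup S≷ T∈
comparable-∈ (T≷ ∷ _)  (there S∈) (here refl) = [ inj₂ , inj₁ ]′ (All.lookup T≷ S∈)
comparable-∈ (_ ∷ σ≷)  (there S∈) (there T∈) = comparable-∈ σ≷ S∈ T∈

⊆ˡ-refl : (xs : List A) → xs ⊆ˡ xs
⊆ˡ-refl xs = All.tabulate id

allPairs-∈ : {R : A → A → Set} (xs : List A) → (∀ {x y} → x ∈ˡ xs → y ∈ˡ xs → R x y) → AllPairs R xs
allPairs-∈ []       R∈ = []
allPairs-∈ (x ∷ xs) R∈ = All.tabulate (R∈ (here refl) ∘ there) ∷ allPairs-∈ xs (λ x∈ y∈ → R∈ (there x∈) (there y∈))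

allPairs-mapWithAll : {P : A → Set} {R S : A → A → Set} → (∀ {x y} → P x → P y → R x y → S x y) →
                      ∀ {xs} → All P xs → AllPairs R xs → AllPairs S xs
allPairs-mapWithAll f []         []         = []
allPairs-mapWithAll f (Px ∷ Pxs) (Rx ∷ Rxs) =
  All.zipWith (λ (Py , Rxy) → f Px Py Rxy) (Pxs , Rx) ∷ allPairs-mapWithAll f Pxs Rxs

module _ {P Q : A → Set} (P? : Decidable P) (Q? : Decidable Q) where

  length-filter-mono : ∀ xs → (∀ {x} → x ∈ˡ xs → P x → Q x) → length (filter P? xs) ≤ length (filter Q? xs)
  length-filter-mono []       P⇒Q = z≤n
  length-filter-mono (x ∷ xs) P⇒Q with P? x | Q? x
  ... | yes _  | yes _  = s≤s (length-filter-mono xs (P⇒Q ∘ there))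
  ... | yes Px | no ¬Qx = contradiction (P⇒Q (here refl) Px) ¬Qx
  ... | no _   | yes _  = ℕₚ.m≤n⇒m≤1+n (length-filter-mono xs (P⇒Q ∘ there))
  ... | no _   | no _   = length-filter-mono xs (P⇒Q ∘ there)

  length-filter-strictMono : ∀ xs → (∀ {x} → x ∈ˡ xs → P x → Q x) → (∃ λ x → x ∈ˡ xs × Q x × ¬ P x) →
                             length (filter P? xs) < length (filter Q? xs)
  length-filter-strictMono (y ∷ xs) P⇒Q (x , here refl , Qx , ¬Px) with P? x | Q? x
  ... | yes Px | _      = contradiction Px ¬Px
  ... | no _   | yes _  = s≤s (length-filter-mono xs (P⇒Q ∘ there))
  ... | no _   | no ¬Qx = contradiction Qx ¬Qx
  length-filter-strictMono (y ∷ xs) P⇒Q (x , there x∈ , w) with P? y | Q? y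
  ... | yes _  | yes _  = s≤s (length-filter-strictMono xs (P⇒Q ∘ there) (x , x∈ , w))
  ... | yes Py | no ¬Qy = contradiction (P⇒Q (here refl) Py) ¬Qy
  ... | no _   | yes _  = ℕₚ.m≤n⇒m≤1+n (length-filter-strictMono xs (P⇒Q ∘ there) (x , x∈ , w))
  ... | no _   | no _   = length-filter-strictMono xs (P⇒Q ∘ there) (x , x∈ , w)

length-filter<⇒∃¬ : {P : A → Set} (P? : Decidable P) → ∀ xs → length (filter P? xs) < length xs →
                     ∃ λ x → x ∈ˡ xs × ¬ P x
length-filter<⇒∃¬ P? (x ∷ xs) lt with P? x
... | yes _  = let y , y∈ , ¬Py = length-filter<⇒∃¬ P? xs (ℕₚ.≤-pred lt) in y , there y∈ , ¬Py
... | no ¬Px = x , here refl , ¬Px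

length-filter-unique : {P : A → Set} (P? : Decidable P) {j : A} → ¬ P j → (∀ {x} → x ≢ j → P x) →
                       ∀ xs → Unique xs → j ∈ˡ xs → suc (length (filter P? xs)) ≡ length xs
length-filter-unique P? ¬Pj P≢ (y ∷ ys) (j∉ys ∷ _) (here refl) =
  cong (suc ∘ length) (trans (Listₚ.filter-reject P? ¬Pj) (Listₚ.filter-all P? (All.map (λ j≢x → P≢ (j≢x ∘ sym)) j∉ys)))
length-filter-unique P? ¬Pj P≢ (y ∷ ys) (y∉ys ∷ ys!) (there j∈ys) =
  trans (cong (suc ∘ length) (Listₚ.filter-accept P? (P≢ (All.lookup y∉ys j∈ys))))
        (cong suc (length-filter-unique P? ¬Pj P≢ ys ys! j∈ys))

module _ (_≟_ : (x y : A) → Dec (x ≡ y)) where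

  private
    remove : A → List A → List A
    remove x = filter (¬? ∘ (x ≟_))

    length-remove : ∀ {x} ys → x ∈ˡ ys → suc (length (remove x ys)) ≤ length ys
    length-remove {x} (y ∷ ys) (here refl) with x ≟ x
    ... | yes _  = s≤s (Listₚ.length-filter (¬? ∘ (x ≟_)) ys)
    ... | no x≢x = contradiction refl x≢x
    length-remove {x} (y ∷ ys) (there x∈) with x ≟ y
    ... | yes _ = s≤s (ℕₚ.≤-trans (ℕₚ.n≤1+n _) (length-remove ys x∈))
    ... | no _  = s≤s (length-remove ys x∈)

  unique⇒length≤ : ∀ (xs ys : List A) → Unique xs → xs ⊆ˡ ys → length xs ≤ length ys
  unique⇒length≤ []       ys _           _           = z≤n
  unique⇒length≤ (x ∷ xs) ys (x∉xs ∷ xs!) (x∈ys ∷ xs⊆ys) = ℕₚ.≤-trans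
    (s≤s (unique⇒length≤ xs (remove x ys) xs!
      (All.zipWith (λ (z∈ys , x≢z) → Memₚ.∈-filter⁺ (¬? ∘ (x ≟_)) z∈ys x≢z) (xs⊆ys , x∉xs))))
    (length-remove ys x∈ys)

-- Prefix chains of ordered set partitions

record Partition (acc : Subset n) (b : List (Subset n)) : Set where
  field
    nonempty : All Nonempty b
    disjoint : AllPairs Disjoint b
    fresh    : All (Disjoint acc) b
    covers   : ∀ x → x ∈ acc ⊎ Any (x ∈_) b
open Partition

partition-∷ : {acc L : Subset n} {b : List (Subset n)} → Partition acc (L ∷ b) → Partition (acc ∪ L) b
partition-∷ {acc = acc} {L} P = record
  { nonempty = All.tail (nonempty P)
  ; disjoint = AllPairs.tail (disjoint P)
  ; fresh    = All.zipWith (λ (acc#L′ , L#L′) → ∪-disjoint acc#L′ L#L′) (All.tail (fresh P) , AllPairs.head (disjoint P))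
  ; covers   = covers′
  }
  where
  covers′ : ∀ x → x ∈ acc ∪ L ⊎ Any (x ∈_) _
  covers′ x with covers P x
  ... | inj₁ x∈acc       = inj₁ (x∈p∪q⁺ (inj₁ x∈acc))
  ... | inj₂ (here x∈L)  = inj₁ (x∈p∪q⁺ (inj₂ x∈L))
  ... | inj₂ (there x∈b) = inj₂ x∈b

partition-resp-↭ : {acc : Subset n} {b b′ : List (Subset n)} → b ↭ b′ → Partition acc b → Partition acc b′
partition-resp-↭ {n = n} b↭b′ P = record
  { nonempty = All-resp-↭ b↭b′ (nonempty P)
  ; disjoint = ↭ₛ.AllPairs-resp-↭ (setoid (Subset n)) (λ S#T x x∈T x∈S → S#T x x∈S x∈T) (resp₂ Disjoint)
                 (↭⇒↭ₛ b↭b′) (disjoint P)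
  ; fresh    = All-resp-↭ b↭b′ (fresh P)
  ; covers   = Sum.map₂ (Any-resp-↭ b↭b′) ∘ covers P
  }

prefixChain : Subset n → List (Subset n) → List (Subset n)
prefixChain acc []           = []
prefixChain acc (_ ∷ [])     = []
prefixChain acc (L ∷ L′ ∷ b) = acc ∪ L ∷ prefixChain (acc ∪ L) (L′ ∷ b)

take-prefixUnions : (acc : Subset n) (b : List (Subset n)) →
                    List.take (length b ∸ 1) (prefixUnions acc b) ≡ prefixChain acc b
take-prefixUnions acc []           = refl
take-prefixUnions acc (_ ∷ [])     = refl
take-prefixUnions acc (L ∷ L′ ∷ b) = cong (acc ∪ L ∷_) (take-prefixUnions (acc ∪ L) (L′ ∷ b))

length-prefixChain : (acc : Subset n) (b : List (Subset n)) → length (prefixChain acc b) ≡ length b ∸ 1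
length-prefixChain acc []           = refl
length-prefixChain acc (_ ∷ [])     = refl
length-prefixChain acc (L ∷ L′ ∷ b) = cong suc (length-prefixChain (acc ∪ L) (L′ ∷ b))

prefixChain-⊇ : (acc : Subset n) (b : List (Subset n)) → All (acc ⊆_) (prefixChain acc b)
prefixChain-⊇ acc []           = []
prefixChain-⊇ acc (_ ∷ [])     = []
prefixChain-⊇ acc (L ∷ L′ ∷ b) =
  p⊆p∪q L ∷ All.map (⊆-trans (p⊆p∪q L)) (prefixChain-⊇ (acc ∪ L) (L′ ∷ b))

prefixChain-⊇head : (acc L : Subset n) (b : List (Subset n)) → All (acc ∪ L ⊆_) (prefixChain acc (L ∷ b))
prefixChain-⊇head acc L []       = []
prefixChain-⊇head acc L (L′ ∷ b) = id ∷ prefixChain-⊇ (acc ∪ L) (L′ ∷ b)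

prefixChain-chain : (acc : Subset n) (b : List (Subset n)) → AllPairs _⊆_ (prefixChain acc b)
prefixChain-chain acc []           = []
prefixChain-chain acc (_ ∷ [])     = []
prefixChain-chain acc (L ∷ L′ ∷ b) = prefixChain-⊇ (acc ∪ L) (L′ ∷ b) ∷ prefixChain-chain (acc ∪ L) (L′ ∷ b)

prefixChain-unsplit : {x y : Fin n} (acc : Subset n) (b : List (Subset n)) → Unsplit acc x y →
                      All (λ L → Unsplit L x y) b → All (λ T → Unsplit T x y) (prefixChain acc b)
prefixChain-unsplit acc []           _ _ = []
prefixChain-unsplit acc (_ ∷ [])     _ _ = []
prefixChain-unsplit acc (L ∷ L′ ∷ b) u (uL ∷ us) =
  ∪-unsplit acc L u uL ∷ prefixChain-unsplit (acc ∪ L) (L′ ∷ b) (∪-unsplit acc L u uL) us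

prefixChain-InBhat : {acc : Subset n} {b : List (Subset n)} → Partition acc b → All InBhat (prefixChain acc b)
prefixChain-InBhat {b = []}         _ = []
prefixChain-InBhat {b = _ ∷ []}     _ = []
prefixChain-InBhat {acc = acc} {L ∷ L′ ∷ b} P =
  inBhat (All.head (nonempty P)) (All.head (nonempty P′)) (All.head (fresh P′)) ∷ prefixChain-InBhat P′
  where
  P′ = partition-∷ P
  inBhat : Nonempty L → Nonempty L′ → Disjoint (acc ∪ L) L′ → InBhat (acc ∪ L)
  inBhat (x , x∈L) (y , y∈L′) acc∪L#L′ = (x , x∈p∪q⁺ (inj₂ x∈L)) , (y , λ y∈ → acc∪L#L′ y y∈ y∈L′)

acc∉prefixChain : {acc L : Subset n} (b : List (Subset n)) → Nonempty L → Disjoint acc L →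
                  ¬ (acc ∈ˡ prefixChain acc (L ∷ b))
acc∉prefixChain {acc = acc} {L} b (w , w∈L) acc#L acc∈ =
  acc#L w (All.lookup (prefixChain-⊇head acc L b) acc∈ (x∈p∪q⁺ (inj₂ w∈L))) w∈L

prefixChain-unique : {acc : Subset n} {b : List (Subset n)} → Partition acc b → Unique (prefixChain acc b)
prefixChain-unique {b = []}         _ = []
prefixChain-unique {b = _ ∷ []}     _ = []
prefixChain-unique {b = L ∷ L′ ∷ b} P =
  All.tabulate (λ T∈ eq → acc∉prefixChain b (All.head (nonempty P′)) (All.head (fresh P′)) (subst (_∈ˡ _) (sym eq) T∈))
  ∷ prefixChain-unique P′
  where P′ = partition-∷ P

UnionOfBlocks : Subset n → List (Subset n) → Set
UnionOfBlocks S = All (λ L → L ⊆ S ⊎ Disjoint L S)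

InsideFirst : Subset n → List (Subset n) → Set
InsideFirst S = AllPairs (λ L L′ → L′ ⊆ S → L ⊆ S)

-- S is acc together with an initial segment of the blocks, and properness excludes the full union
∈-prefixChain : {acc S : Subset n} {b : List (Subset n)} → Partition acc b → acc ⊆ S →
                (∃ λ x → x ∈ S × x ∉ acc) → Proper S → UnionOfBlocks S b → InsideFirst S b →
                S ∈ˡ prefixChain acc b
∈-prefixChain {b = []} P _ (x , _ , x∉acc) _ _ _ with covers P x
... | inj₁ x∈acc = contradiction x∈acc x∉acc
∈-prefixChain {b = L ∷ []} P acc⊆S (x , x∈S , x∉acc) (y , y∉S) (L≷S ∷ []) _
  with covers P x | covers P y | L≷S
... | inj₁ x∈acc      | _               | _        = contradiction x∈acc x∉acc
... | inj₂ (here x∈L) | _               | inj₂ L#S = ⊥-elim (L#S x x∈L x∈S)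
... | inj₂ (here _)   | inj₁ y∈acc      | inj₁ _   = contradiction (acc⊆S y∈acc) y∉S
... | inj₂ (here _)   | inj₂ (here y∈L) | inj₁ L⊆S = contradiction (L⊆S y∈L) y∉S
∈-prefixChain {acc = acc} {S} {L ∷ L′ ∷ b} P acc⊆S new proper (inj₁ L⊆S ∷ blocks) (_ ∷ first)
  with ⊆⊎witness S (acc ∪ L)
... | inj₁ S⊆acc∪L = here (⊆-antisym S⊆acc∪L ([ acc⊆S , L⊆S ]′ ∘ x∈p∪q⁻ acc L))
... | inj₂ new′    = there (∈-prefixChain (partition-∷ P) ([ acc⊆S , L⊆S ]′ ∘ x∈p∪q⁻ acc L) new′ proper blocks first)
∈-prefixChain {acc = acc} {S} {L ∷ L′ ∷ b} P acc⊆S (x , x∈S , x∉acc) _ (inj₂ L#S ∷ blocks) (L≼ ∷ _)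
  with covers P x
... | inj₁ x∈acc         = contradiction x∈acc x∉acc
... | inj₂ (here x∈L)    = ⊥-elim (L#S x x∈L x∈S)
... | inj₂ (there x∈blk) with find x∈blk
...   | L″ , L″∈ , x∈L″ with All.lookup blocks L″∈
...     | inj₂ L″#S = ⊥-elim (L″#S x x∈L″ x∈S)
...     | inj₁ L″⊆S with All.head (nonempty P)
...       | w , w∈L = ⊥-elim (L#S w w∈L (All.lookup L≼ L″∈ L″⊆S w∈L))

prefixChain-splits : {acc : Subset n} {b : List (Subset n)} {x y : Fin n} → Partition acc b →
                     x ∉ acc → y ∉ acc → All (λ L → ¬ (x ∈ L × y ∈ L)) b →
                     ∃ λ T → T ∈ˡ prefixChain acc b × Splits T x y
prefixChain-splits {b = []} {x} P x∉acc _ _ with covers P x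
... | inj₁ x∈acc = contradiction x∈acc x∉acc
prefixChain-splits {b = L ∷ []} {x} {y} P x∉acc y∉acc (¬xy∈L ∷ []) with covers P x | covers P y
... | inj₁ x∈acc      | _               = contradiction x∈acc x∉acc
... | _               | inj₁ y∈acc      = contradiction y∈acc y∉acc
... | inj₂ (here x∈L) | inj₂ (here y∈L) = contradiction (x∈L , y∈L) ¬xy∈L
prefixChain-splits {acc = acc} {L ∷ L′ ∷ b} {x} {y} P x∉acc y∉acc (¬xy∈L ∷ ¬xy∈) with x ∈? L | y ∈? L
... | yes x∈L | yes y∈L = contradiction (x∈L , y∈L) ¬xy∈L
... | yes x∈L | no y∉L  = acc ∪ L , here refl , inj₁ (x∈p∪q⁺ (inj₂ x∈L) , [ y∉acc , y∉L ]′ ∘ x∈p∪q⁻ acc L)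
... | no x∉L  | yes y∈L = acc ∪ L , here refl , inj₂ (x∈p∪q⁺ (inj₂ y∈L) , [ x∉acc , x∉L ]′ ∘ x∈p∪q⁻ acc L)
... | no x∉L  | no y∉L  =
  let T , T∈ , splits = prefixChain-splits (partition-∷ P) ([ x∉acc , x∉L ]′ ∘ x∈p∪q⁻ acc L)
                          ([ y∉acc , y∉L ]′ ∘ x∈p∪q⁻ acc L) ¬xy∈
  in T , there T∈ , splits

comparable⇒insideFirst : {acc S : Subset n} {b : List (Subset n)} → Partition acc b →
                         (∀ {T} → T ∈ˡ prefixChain acc b → Comparable T S) → InsideFirst S b
comparable⇒insideFirst {b = []}         _ _ = []
comparable⇒insideFirst {b = _ ∷ []}     _ _ = [] ∷ []
comparable⇒insideFirst {acc = acc} {S} {L ∷ L′ ∷ b} P cmp =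
  All.zipWith later⊆S⇒L⊆S (nonempty P′ , fresh P′) ∷ comparable⇒insideFirst P′ (cmp ∘ there)
  where
  P′ = partition-∷ P
  later⊆S⇒L⊆S : ∀ {L″} → Nonempty L″ × Disjoint (acc ∪ L) L″ → L″ ⊆ S → L ⊆ S
  later⊆S⇒L⊆S ((w , w∈L″) , acc∪L#L″) L″⊆S with cmp (here refl)
  ... | inj₁ acc∪L⊆S = ⊆-trans (q⊆p∪q acc L) acc∪L⊆S
  ... | inj₂ S⊆acc∪L = ⊥-elim (acc∪L#L″ w (S⊆acc∪L (L″⊆S w∈L″)) w∈L″)

private
  ≋-tail : {h : Subset n} {t t′ : List (Subset n)} → (h ∷ t) ≋ (h ∷ t′) → ¬ (h ∈ˡ t) → ¬ (h ∈ˡ t′) → t ≋ t′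
  ≋-tail {h = h} (⊆′ , ⊇′) h∉t h∉t′ = drop (All.tail ⊆′) h∉t , drop (All.tail ⊇′) h∉t′
    where
    drop : ∀ {u u′} → All (_∈ˡ (h ∷ u′)) u → ¬ (h ∈ˡ u) → All (_∈ˡ u′) u
    drop []                 _   = []
    drop (here refl  ∷ u⊆) h∉u = contradiction (here refl) h∉u
    drop (there T∈u′ ∷ u⊆) h∉u = T∈u′ ∷ drop u⊆ (h∉u ∘ there)

  ∪-cancelˡ : {acc L L′ : Subset n} → Disjoint acc L → Disjoint acc L′ → acc ∪ L ≡ acc ∪ L′ → L ≡ L′
  ∪-cancelˡ {acc = acc} {L} {L′} acc#L acc#L′ eq = ⊆-antisym (incl acc#L eq) (incl acc#L′ (sym eq))
    where
    incl : ∀ {L₁ L₂} → Disjoint acc L₁ → acc ∪ L₁ ≡ acc ∪ L₂ → L₁ ⊆ L₂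
    incl {L₁} {L₂} acc#L₁ eq {z} z∈L₁ =
      [ (λ z∈acc → contradiction z∈L₁ (acc#L₁ z z∈acc)) , id ]′
        (x∈p∪q⁻ acc L₂ (subst (z ∈_) eq (x∈p∪q⁺ (inj₂ z∈L₁))))

prefixChain-injective : {acc : Subset n} {b b′ : List (Subset n)} → Partition acc b → Partition acc b′ →
                        length b ≡ length b′ → prefixChain acc b ≋ prefixChain acc b′ → b ≡ b′
prefixChain-injective {b = []}     {[]}     _ _ _ _ = refl
prefixChain-injective {b = L ∷ []} {L′ ∷ []} P P′ _ _ = cong [_] (⊆-antisym (incl P P′) (incl P′ P))
  where
  incl : ∀ {acc L₁ L₂} → Partition acc (L₁ ∷ []) → Partition acc (L₂ ∷ []) → L₁ ⊆ L₂
  incl P₁ P₂ {z} z∈L₁ with covers P₂ z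
  ... | inj₁ z∈acc        = contradiction z∈L₁ (All.head (fresh P₁) z z∈acc)
  ... | inj₂ (here z∈L₂) = z∈L₂
prefixChain-injective {acc = acc} {L ∷ L₂ ∷ b} {L′ ∷ L₂′ ∷ b′} P P′ eq chain≋chain′ =
  cong₂ _∷_ L≡L′ (prefixChain-injective P₂ P₂′ (cong ℕ.pred eq) tails≋)
  where
  L≡L′ : L ≡ L′
  L≡L′ = ∪-cancelˡ (All.head (fresh P)) (All.head (fresh P′))
    (⊆-antisym (All.lookup (prefixChain-⊇head acc L (L₂ ∷ b)) (All.head (proj₂ chain≋chain′)))
               (All.lookup (prefixChain-⊇head acc L′ (L₂′ ∷ b′)) (All.head (proj₁ chain≋chain′))))
  P₂ : Partition (acc ∪ L) (L₂ ∷ b)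
  P₂ = partition-∷ P
  P₂′ : Partition (acc ∪ L) (L₂′ ∷ b′)
  P₂′ = subst (λ X → Partition (acc ∪ X) (L₂′ ∷ b′)) (sym L≡L′) (partition-∷ P′)
  tails≋ : prefixChain (acc ∪ L) (L₂ ∷ b) ≋ prefixChain (acc ∪ L) (L₂′ ∷ b′)
  tails≋ = ≋-tail (subst (λ X → _ ≋ (acc ∪ X ∷ prefixChain (acc ∪ X) (L₂′ ∷ b′))) (sym L≡L′) chain≋chain′)
                  (acc∉prefixChain b (All.head (nonempty P₂)) (All.head (fresh P₂)))
                  (acc∉prefixChain b′ (All.head (nonempty P₂′)) (All.head (fresh P₂′)))
prefixChain-injective {b = []}         {_ ∷ _}         _ _ () _
prefixChain-injective {b = _ ∷ _}      {[]}            _ _ () _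
prefixChain-injective {b = _ ∷ []}     {_ ∷ _ ∷ _}     _ _ () _
prefixChain-injective {b = _ ∷ _ ∷ _}  {_ ∷ []}        _ _ () _

-- Edge-spheres

module _ {d : ℕ} {G : SimpleGraph d} where

  EdgeUnsplit : Edge G → Subset d → Set
  EdgeUnsplit e S = Unsplit S (ei e) (ej e)

  ei≢ej : (e : Edge G) → ei e ≢ ej e
  ei≢ej e eq = ℕₚ.<-irrefl (cong toℕ eq) (lt e)

module EdgeSphere {d : ℕ} {G : SimpleGraph d} (e : Edge G) where

  private
    a b : Fin d
    a = ei e
    b = ej e

  InEdge : Fin d → Set
  InEdge z = z ≡ a ⊎ z ≡ b

  data EdgeBlock : Subset d → Set where
    single : ∀ {x} → ¬ InEdge x → EdgeBlock ⁅ x ⁆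
    pair   : EdgeBlock (⁅ a ⁆ ∪ ⁅ b ⁆)

  private
    a∈pair : a ∈ ⁅ a ⁆ ∪ ⁅ b ⁆
    a∈pair = x∈p∪q⁺ (inj₁ (x∈⁅x⁆ a))

    b∈pair : b ∈ ⁅ a ⁆ ∪ ⁅ b ⁆
    b∈pair = x∈p∪q⁺ (inj₂ (x∈⁅x⁆ b))

    ∈pair⁻ : ∀ {z} → z ∈ ⁅ a ⁆ ∪ ⁅ b ⁆ → InEdge z
    ∈pair⁻ = Sum.map (x∈⁅y⁆⇒x≡y a) (x∈⁅y⁆⇒x≡y b) ∘ x∈p∪q⁻ ⁅ a ⁆ ⁅ b ⁆

  edgeBlock-nonempty : ∀ {L} → EdgeBlock L → Nonempty L
  edgeBlock-nonempty (single {x} _) = x , x∈⁅x⁆ x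
  edgeBlock-nonempty pair           = a , a∈pair

  edgeBlock-unsplit : ∀ {L} → EdgeBlock L → Unsplit L a b
  edgeBlock-unsplit (single {x} x∉e) =
    (λ a∈ → contradiction (inj₁ (sym (x∈⁅y⁆⇒x≡y x a∈))) x∉e) , (λ b∈ → contradiction (inj₂ (sym (x∈⁅y⁆⇒x≡y x b∈))) x∉e)
  edgeBlock-unsplit pair = const b∈pair , const a∈pair

  edgeBlock-⊆⊎disjoint : ∀ {L S} → EdgeBlock L → Unsplit S a b → L ⊆ S ⊎ Disjoint L S
  edgeBlock-⊆⊎disjoint {S = S} (single {x} _) _ with x ∈? S
  ... | yes x∈S = inj₁ λ z∈ → subst (_∈ S) (sym (x∈⁅y⁆⇒x≡y x z∈)) x∈S
  ... | no  x∉S = inj₂ λ z z∈ z∈S → x∉S (subst (_∈ S) (x∈⁅y⁆⇒x≡y x z∈) z∈S)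
  edgeBlock-⊆⊎disjoint {S = S} pair (a⇒b , b⇒a) with a ∈? S
  ... | yes a∈S = inj₁ λ z∈ → [ (λ { refl → a∈S }) , (λ { refl → a⇒b a∈S }) ]′ (∈pair⁻ z∈)
  ... | no  a∉S = inj₂ λ z z∈ z∈S → a∉S ([ (λ { refl → z∈S }) , (λ { refl → b⇒a z∈S }) ]′ (∈pair⁻ z∈))

  edgeBlock-¬both : ∀ {L x y} → x ≢ y → ¬ (InEdge x × InEdge y) → EdgeBlock L → ¬ (x ∈ L × y ∈ L)
  edgeBlock-¬both {x = x} {y} x≢y _ (single {z} _) (x∈ , y∈) = x≢y (trans (x∈⁅y⁆⇒x≡y z x∈) (sym (x∈⁅y⁆⇒x≡y z y∈)))
  edgeBlock-¬both _ ¬xy∈e pair (x∈ , y∈) = ¬xy∈e (∈pair⁻ x∈ , ∈pair⁻ y∈)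

  blockOf : Fin d → Subset d
  blockOf x = if does (x Fin.≟ a) then ⁅ a ⁆ ∪ ⁅ b ⁆ else ⁅ x ⁆

  private
    keep : Fin d → Bool
    keep x = not (does (x Fin.≟ b))

    kept : List (Fin d)
    kept = filterᵇ keep (List.allFin d)

    T-keep⇒≢ : ∀ {x} → T (keep x) → x ≢ b
    T-keep⇒≢ {x} T-keep with x Fin.≟ b
    ... | no x≢b = x≢b

    ≢⇒T-keep : ∀ {x} → x ≢ b → T (keep x)
    ≢⇒T-keep {x} x≢b with x Fin.≟ b
    ... | yes x≡b = x≢b x≡b
    ... | no _    = _

    kept-≢ : All (_≢ b) kept
    kept-≢ = All.map T-keep⇒≢ (Allₚ.all-filter (T? ∘ keep) (List.allFin d))

    ∈-kept : ∀ {x} → x ≢ b → blockOf x ∈ˡ letters e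
    ∈-kept {x} x≢b = Memₚ.∈-map⁺ blockOf (Memₚ.∈-filter⁺ (T? ∘ keep) (Memₚ.∈-allFin x) (≢⇒T-keep x≢b))

    blockOf-edgeBlock : ∀ {x} → x ≢ b → EdgeBlock (blockOf x)
    blockOf-edgeBlock {x} x≢b with x Fin.≟ a
    ... | yes refl = pair
    ... | no x≢a   = single [ x≢a , x≢b ]′

    x∈blockOf : ∀ x → x ∈ blockOf x
    x∈blockOf x with x Fin.≟ a
    ... | yes refl = a∈pair
    ... | no _     = x∈⁅x⁆ x

    b∈blockOf-a : b ∈ blockOf a
    b∈blockOf-a with a Fin.≟ a
    ... | yes _  = b∈pair
    ... | no a≢a = contradiction refl a≢a

    ∈-blockOf⁻ : ∀ {x z} → z ∈ blockOf x → (x ≡ a × InEdge z) ⊎ z ≡ x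
    ∈-blockOf⁻ {x} z∈ with x Fin.≟ a
    ... | yes x≡a = inj₁ (x≡a , ∈pair⁻ z∈)
    ... | no _    = inj₂ (x∈⁅y⁆⇒x≡y x z∈)

    blockOf-disjoint : ∀ {x y} → x ≢ b → y ≢ b → x ≢ y → Disjoint (blockOf x) (blockOf y)
    blockOf-disjoint {x} {y} x≢b y≢b x≢y z z∈x z∈y with ∈-blockOf⁻ {x} z∈x | ∈-blockOf⁻ {y} z∈y
    ... | inj₁ (refl , _)        | inj₁ (refl , _)        = x≢y refl
    ... | inj₂ refl              | inj₂ refl              = x≢y refl
    ... | inj₁ (refl , inj₁ refl) | inj₂ refl             = x≢y refl
    ... | inj₁ (refl , inj₂ refl) | inj₂ refl             = y≢b refl
    ... | inj₂ refl              | inj₁ (refl , inj₁ refl) = x≢y refl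
    ... | inj₂ refl              | inj₁ (refl , inj₂ refl) = x≢b refl

  letters-edgeBlock : All EdgeBlock (letters e)
  letters-edgeBlock = Allₚ.map⁺ (All.map blockOf-edgeBlock kept-≢)

  letters-partition : Partition Sub.⊥ (letters e)
  letters-partition = record
    { nonempty = All.map edgeBlock-nonempty letters-edgeBlock
    ; disjoint = AllPairsₚ.map⁺ (allPairs-mapWithAll blockOf-disjoint kept-≢
                   (AllPairsₚ.filter⁺ (T? ∘ keep) (Unique-allFin d)))
    ; fresh    = All.tabulate (λ _ _ x∈⊥ → contradiction x∈⊥ ∉⊥)
    ; covers   = λ z → inj₂ (covered z)
    }
    where
    covered : ∀ z → Any (z ∈_) (letters e)
    covered z with z Fin.≟ b
    ... | yes refl = lose (∈-kept (ei≢ej e)) b∈blockOf-a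
    ... | no z≢b   = lose (∈-kept z≢b) (x∈blockOf z)

  length-letters : length (letters e) ≡ d ∸ 1
  length-letters = begin
    length (letters e)          ≡⟨ Listₚ.length-map blockOf kept ⟩
    length kept                 ≡⟨ cong (_∸ 1) (length-filter-unique (T? ∘ keep) (λ T-keep → T-keep⇒≢ T-keep refl)
                                                 ≢⇒T-keep (List.allFin d) (Unique-allFin d) (Memₚ.∈-allFin b)) ⟩
    length (List.allFin d) ∸ 1  ≡⟨ cong (_∸ 1) (Listₚ.length-tabulate {n = d} id) ⟩
    d ∸ 1                       ∎
    where open ≡-Reasoning

  module _ {w : List (Subset d)} (p : EPerm e w) where

    ePerm-edgeBlock : All EdgeBlock w
    ePerm-edgeBlock = All-resp-↭ (↭-sym p) letters-edgeBlock

    ePerm-partition : Partition Sub.⊥ w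
    ePerm-partition = partition-resp-↭ (↭-sym p) letters-partition

    ePerm-length : length w ≡ d ∸ 1
    ePerm-length = trans (↭-length p) length-letters

    facetOf≡prefixChain : facetOf w ≡ prefixChain Sub.⊥ w
    facetOf≡prefixChain = begin
      List.take (d ∸ 2) (prefixUnions Sub.⊥ w)          ≡⟨ cong (λ k → List.take k (prefixUnions Sub.⊥ w)) d∸2≡ ⟩
      List.take (length w ∸ 1) (prefixUnions Sub.⊥ w)   ≡⟨ take-prefixUnions Sub.⊥ w ⟩
      prefixChain Sub.⊥ w                                ∎
      where
      open ≡-Reasoning
      d∸2≡ : d ∸ 2 ≡ length w ∸ 1
      d∸2≡ = trans (sym (ℕₚ.∸-+-assoc d 1 1)) (cong (_∸ 1) (sym ePerm-length))

    facet-InBhat : All InBhat (facetOf w)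
    facet-InBhat = subst (All InBhat) (sym facetOf≡prefixChain) (prefixChain-InBhat ePerm-partition)

    facet-unsplit : All (EdgeUnsplit e) (facetOf w)
    facet-unsplit = subst (All (EdgeUnsplit e)) (sym facetOf≡prefixChain)
      (prefixChain-unsplit Sub.⊥ w (contradiction′ , contradiction′) (All.map edgeBlock-unsplit ePerm-edgeBlock))
      where
      contradiction′ : ∀ {x y : Fin d} → x ∈ Sub.⊥ → y ∈ Sub.⊥
      contradiction′ x∈⊥ = contradiction x∈⊥ ∉⊥

    facet-chain : AllPairs Comparable (facetOf w)
    facet-chain = subst (AllPairs Comparable) (sym facetOf≡prefixChain)
      (AllPairs.map inj₁ (prefixChain-chain Sub.⊥ w))

    facet-length : length (facetOf w) ≡ d ∸ 2
    facet-length = begin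
      length (facetOf w)                 ≡⟨ cong length facetOf≡prefixChain ⟩
      length (prefixChain Sub.⊥ w)       ≡⟨ length-prefixChain Sub.⊥ w ⟩
      length w ∸ 1                       ≡⟨ cong (_∸ 1) ePerm-length ⟩
      d ∸ 1 ∸ 1                          ≡⟨ ℕₚ.∸-+-assoc d 1 1 ⟩
      d ∸ 2                              ∎
      where open ≡-Reasoning

    facet-unique : Unique (facetOf w)
    facet-unique = subst Unique (sym facetOf≡prefixChain) (prefixChain-unique ePerm-partition)

    insideFirst⇒∈facet : ∀ {S} → InBhat S → EdgeUnsplit e S → InsideFirst S w → S ∈ˡ facetOf w
    insideFirst⇒∈facet {S} ((x , x∈S) , proper) S-unsplit first = subst (S ∈ˡ_) (sym facetOf≡prefixChain)
      (∈-prefixChain ePerm-partition (⊆-min S) (x , x∈S , ∉⊥) proper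
        (All.map (λ blk → edgeBlock-⊆⊎disjoint blk S-unsplit) ePerm-edgeBlock) first)

    ∈-facet : ∀ {S} → InBhat S → EdgeUnsplit e S → (∀ {T} → T ∈ˡ facetOf w → Comparable T S) → S ∈ˡ facetOf w
    ∈-facet S-InBhat S-unsplit cmp = insideFirst⇒∈facet S-InBhat S-unsplit
      (comparable⇒insideFirst ePerm-partition (cmp ∘ subst (_ ∈ˡ_) (sym facetOf≡prefixChain)))

    facet-splits : ∀ {x y} → x ≢ y → ¬ (InEdge x × InEdge y) → ∃ λ T → T ∈ˡ facetOf w × Splits T x y
    facet-splits x≢y ¬xy∈e =
      let T , T∈ , splits = prefixChain-splits ePerm-partition ∉⊥ ∉⊥ (All.map (edgeBlock-¬both x≢y ¬xy∈e) ePerm-edgeBlock)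
      in T , subst (T ∈ˡ_) (sym facetOf≡prefixChain) T∈ , splits

  facetOf-injective : ∀ {w w′} → EPerm e w → EPerm e w′ → facetOf w ≋ facetOf w′ → w ≡ w′
  facetOf-injective p p′ facet≋ = prefixChain-injective (ePerm-partition p) (ePerm-partition p′)
    (trans (ePerm-length p) (sym (ePerm-length p′)))
    (subst₂ _≋_ (facetOf≡prefixChain p) (facetOf≡prefixChain p′) facet≋)

  inSphere⇒unsplitChain : ∀ {σ} → InSphere e σ → OCFace d σ × All (EdgeUnsplit e) σ
  inSphere⇒unsplitChain {σ} (w , p , σ⊆facet) =
    (All.map (All.lookup (facet-InBhat p)) σ⊆facet ,
     allPairs-∈ σ (λ S∈ T∈ → comparable-∈ (facet-chain p) (All.lookup σ⊆facet S∈) (All.lookup σ⊆facet T∈))) ,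
    All.map (All.lookup (facet-unsplit p)) σ⊆facet

  unsplitChain⇒inSphere : ∀ {σ} → OCFace d σ → All (EdgeUnsplit e) σ → InSphere e σ
  unsplitChain⇒inSphere {σ} (σ-InBhat , σ-chain) σ-unsplit = w , p , All.tabulate S∈facet
    where
    -- sorting the letters by how many members of σ miss them makes every member of σ a prefix union
    missing : Subset d → ℕ
    missing L = length (filter (λ T → ¬? (L ⊆? T)) σ)
    open Sort (On.decTotalOrder ℕₚ.≤-decTotalOrder missing) using (sort; sort-↭; sort-↗)
    w : List (Subset d)
    w = sort (letters e)
    p : EPerm e w
    p = sort-↭ (letters e)
    S∈facet : ∀ {S} → S ∈ˡ σ → S ∈ˡ facetOf w
    S∈facet {S} S∈σ = insideFirst⇒∈facet p (All.lookup σ-InBhat S∈σ) (All.lookup σ-unsplit S∈σ)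
                        (AllPairs.map insideFirst (Linked⇒AllPairs ℕₚ.≤-trans (sort-↗ (letters e))))
      where
      insideFirst : ∀ {L L′} → missing L ≤ missing L′ → L′ ⊆ S → L ⊆ S
      insideFirst {L} {L′} L≤L′ L′⊆S with L ⊆? S
      ... | yes L⊆S = L⊆S
      ... | no  L⊈S = contradiction L≤L′ (ℕₚ.<⇒≱ (length-filter-strictMono (λ T → ¬? (L′ ⊆? T)) (λ T → ¬? (L ⊆? T)) σ
                        L′⊈⇒L⊈ (S , S∈σ , L⊈S , λ L′⊈S → L′⊈S L′⊆S)))
        where
        L′⊈⇒L⊈ : ∀ {T} → T ∈ˡ σ → ¬ (L′ ⊆ T) → ¬ (L ⊆ T)
        L′⊈⇒L⊈ T∈σ L′⊈T L⊆T with comparable-∈ σ-chain T∈σ S∈σ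
        ... | inj₁ T⊆S = L⊈S (⊆-trans L⊆T T⊆S)
        ... | inj₂ S⊆T = L′⊈T (⊆-trans L′⊆S S⊆T)

-- Longest paths and cuts

module Height {n : ℕ} (R : Fin n → Fin n → Set) (R? : ∀ y x → Dec (R y x))
              (ρ : Fin n → ℕ) (ρ-mono : ∀ {y x} → R y x → ρ y < ρ x) where

  IsHeight : (Fin n → ℕ) → Set
  IsHeight f = ∀ x → (∀ y → R y x → f y < f x) × (f x ≡ 0 ⊎ ∃ λ y → R y x × f x ≡ suc (f y))

  private
    below : Fin n → List (Fin n)
    below x = filter (λ y → R? y x) (List.allFin n)

    ∈-below⁻ : ∀ {x y} → y ∈ˡ below x → R y x
    ∈-below⁻ {x} = proj₂ ∘ Memₚ.∈-filter⁻ (λ y → R? y x) {xs = List.allFin n}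

    ∈-below⁺ : ∀ {x y} → R y x → y ∈ˡ below x
    ∈-below⁺ {x} {y} = Memₚ.∈-filter⁺ (λ y → R? y x) (Memₚ.∈-allFin y)

    heightUpTo : ℕ → Fin n → ℕ
    heightUpTo zero    x = 0
    heightUpTo (suc k) x = max 0 (map (suc ∘ heightUpTo k) (below x))

    heightUpTo-stable : ∀ k k′ x → ρ x < k → ρ x < k′ → heightUpTo k x ≡ heightUpTo k′ x
    heightUpTo-stable (suc k) (suc k′) x (s≤s ρx≤k) (s≤s ρx≤k′) =
      cong (max 0) (Listₚ.map-cong-local (All.tabulate λ y∈ → cong suc (heightUpTo-stable k k′ _
        (ℕₚ.<-≤-trans (ρ-mono (∈-below⁻ y∈)) ρx≤k) (ℕₚ.<-≤-trans (ρ-mono (∈-below⁻ y∈)) ρx≤k′))))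

  module _ (M : ℕ) (ρ≤M : ∀ x → ρ x ≤ M) where

    height : Fin n → ℕ
    height = heightUpTo (suc M)

    private
      height≡ : ∀ {y x} → R y x → height y ≡ heightUpTo M y
      height≡ {y} {x} Ryx = heightUpTo-stable (suc M) M y (s≤s (ρ≤M y)) (ℕₚ.<-≤-trans (ρ-mono Ryx) (ρ≤M x))

    height-isHeight : IsHeight height
    height-isHeight x = increasing , attained
      where
      heights = map (suc ∘ heightUpTo M) (below x)

      increasing : ∀ y → R y x → height y < height x
      increasing y Ryx = subst (λ h → suc h ≤ height x) (sym (height≡ Ryx))
        (All.lookup (xs≤max 0 heights) (Memₚ.∈-map⁺ (suc ∘ heightUpTo M) (∈-below⁺ Ryx)))

      attained : height x ≡ 0 ⊎ ∃ λ y → R y x × height x ≡ suc (height y)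
      attained with argmax-sel id 0 heights
      ... | inj₁ max≡0 = inj₁ max≡0
      ... | inj₂ max∈ with Memₚ.∈-map⁻ (suc ∘ heightUpTo M) max∈
      ...   | y , y∈ , max≡ = inj₂ (y , ∈-below⁻ y∈ , trans max≡ (cong suc (sym (height≡ (∈-below⁻ y∈)))))

adj-irreflexive : {d : ℕ} (G : SimpleGraph d) {x y : Fin d} → adj G x y ≡ true → x ≢ y
adj-irreflexive G {x} xy refl with () ← trans (sym xy) (irrefl G x)

module Cuts {d′ : ℕ} (G : SimpleGraph (suc d′)) (π : Permutation′ (suc d′)) where

  private
    d : ℕ
    d = suc d′

    a : Fin d → Fin d
    a = letter G π

  position : Fin d → Fin d
  position x = π ⟨$⟩ˡ x

  letter-position : ∀ x → a (position x) ≡ x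
  letter-position x = inverseʳ π

  letter-injective : ∀ {p q} → a p ≡ a q → p ≡ q
  letter-injective {p} {q} eq = trans (sym (inverseˡ π)) (trans (cong position eq) (inverseˡ π))

  EarlierNeighbour : Fin d → Fin d → Set
  EarlierNeighbour i p = i Fin.< p × adj G (a i) (a p) ≡ true

  earlierNeighbour? : ∀ i p → Dec (EarlierNeighbour i p)
  earlierNeighbour? i p = (i Finₚ.<? p) ×-dec (adj G (a i) (a p) Bool.≟ true)

  open Height EarlierNeighbour earlierNeighbour? toℕ proj₁ public using (IsHeight)
  open Height EarlierNeighbour earlierNeighbour? toℕ proj₁ using (height; height-isHeight)

  isHeight⇒longest : ∀ {f} → IsHeight f → ∀ p → Longest G π p (f p)
  isHeight⇒longest {f} f-height p = path (f p) p refl , bound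
    where
    path : ∀ r p → f p ≡ r → HasPath G π p r
    path zero    p _    = here p
    path (suc r) p fp≡ with proj₂ (f-height p)
    ... | inj₁ fp≡0                   = contradiction (trans (sym fp≡0) fp≡) ℕₚ.0≢1+n
    ... | inj₂ (i , (i<p , ip) , fp≡′) = step i<p ip (path r i (ℕₚ.suc-injective (trans (sym fp≡′) fp≡)))
    bound : ∀ {p} r → HasPath G π p r → r ≤ f p
    bound _ (here _)                = z≤n
    bound _ (step {i} {k} i<k ik P) = ℕₚ.≤-trans (s≤s (bound _ P)) (proj₁ (f-height k) i (i<k , ik))

  longest-unique : ∀ {p r r′} → Longest G π p r → Longest G π p r′ → r ≡ r′
  longest-unique (P , P-max) (P′ , P′-max) = ℕₚ.≤-antisym (P′-max _ P) (P-max _ P′)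

  ℓ : Fin d → ℕ
  ℓ = height d (ℕₚ.<⇒≤ ∘ toℕ<n)

  ℓ-isHeight : IsHeight ℓ
  ℓ-isHeight = height-isHeight d (ℕₚ.<⇒≤ ∘ toℕ<n)

  ℓ-longest : ∀ p → Longest G π p (ℓ p)
  ℓ-longest = isHeight⇒longest ℓ-isHeight

  cutAt⊎ℓ≤ : ∀ p q → toℕ q ≡ suc (toℕ p) → Cut G π (suc (toℕ p)) ⊎ ℓ q ≤ ℓ p
  cutAt⊎ℓ≤ p q q≡ with ℕₚ.<-cmp (ℓ p) (ℓ q)
  ... | tri< ℓp<ℓq _ _ = inj₁ (cutLt p q q≡ (ℓ p) (ℓ q) (ℓ-longest p) (ℓ-longest q) ℓp<ℓq)
  ... | tri> _ _ ℓq<ℓp = inj₂ (ℕₚ.<⇒≤ ℓq<ℓp)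
  ... | tri≈ _ ℓp≡ℓq _ with a p Finₚ.<? a q
  ...   | yes ap<aq = inj₁ (cutEq p q q≡ (ℓ p) (ℓ-longest p) (subst (Longest G π q) (sym ℓp≡ℓq) (ℓ-longest q)) ap<aq)
  ...   | no _      = inj₂ (ℕₚ.≤-reflexive (sym ℓp≡ℓq))

  private
    consecutive : ∀ {m} (m+1<d : suc m < d) → toℕ (fromℕ< m+1<d) ≡ suc (toℕ (fromℕ< (ℕₚ.<⇒≤ m+1<d)))
    consecutive {m} m+1<d = trans (toℕ-fromℕ< m+1<d) (cong suc (sym (toℕ-fromℕ< (ℕₚ.<⇒≤ m+1<d))))

  cut⊎ℓ≤ : ∀ p m (m<d : m < d) → toℕ p ≤ m → (∃ λ k → Cut G π k × toℕ p < k × k ≤ m) ⊎ ℓ (fromℕ< m<d) ≤ ℓ p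
  cut⊎ℓ≤ p m m<d p≤m with ℕₚ.m≤n⇒m<n∨m≡n p≤m
  ... | inj₂ refl = inj₂ (ℕₚ.≤-reflexive (cong ℓ (fromℕ<-toℕ p m<d)))
  cut⊎ℓ≤ p (suc m) m+1<d _ | inj₁ (s≤s p≤m)
    with cut⊎ℓ≤ p m (ℕₚ.<⇒≤ m+1<d) p≤m | cutAt⊎ℓ≤ (fromℕ< (ℕₚ.<⇒≤ m+1<d)) (fromℕ< m+1<d) (consecutive m+1<d)
  ... | inj₁ (k , cut , p<k , k≤m) | _        = inj₁ (k , cut , p<k , ℕₚ.m≤n⇒m≤1+n k≤m)
  ... | inj₂ _                     | inj₁ cut = inj₁ (_ , cut , s≤s (subst (toℕ p ≤_) (sym (toℕ-fromℕ< _)) p≤m) ,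
                                                      s≤s (ℕₚ.≤-reflexive (toℕ-fromℕ< _)))
  ... | inj₂ ℓm≤ℓp                 | inj₂ ℓ≤ℓm = inj₂ (ℕₚ.≤-trans ℓ≤ℓm ℓm≤ℓp)

  cut-between : ∀ p q → toℕ p < toℕ q → adj G (a p) (a q) ≡ true → ∃ λ k → Cut G π k × toℕ p < k × k ≤ toℕ q
  cut-between p q p<q pq with cut⊎ℓ≤ p (toℕ q) (toℕ<n q) (ℕₚ.<⇒≤ p<q)
  ... | inj₁ cut = cut
  ... | inj₂ ℓq≤ℓp = contradiction (subst (λ q → ℓ q ≤ ℓ p) (fromℕ<-toℕ q (toℕ<n q)) ℓq≤ℓp)
                                   (ℕₚ.<⇒≱ (proj₁ (ℓ-isHeight q) p (p<q , pq)))

  private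
    CutCondition : Fin d → Fin d → Set
    CutCondition p q = toℕ q ≡ suc (toℕ p) × (ℓ p < ℓ q ⊎ (ℓ p ≡ ℓ q × a p Fin.< a q))

    cutCondition? : ∀ p q → Dec (CutCondition p q)
    cutCondition? p q = (toℕ q ℕ.≟ suc (toℕ p)) ×-dec
                        ((ℓ p ℕ.<? ℓ q) ⊎-dec ((ℓ p ℕ.≟ ℓ q) ×-dec (a p Finₚ.<? a q)))

    cutCondition⇒cut : ∀ p q → CutCondition p q → Cut G π (suc (toℕ p))
    cutCondition⇒cut p q (q≡ , inj₁ ℓp<ℓq)          = cutLt p q q≡ (ℓ p) (ℓ q) (ℓ-longest p) (ℓ-longest q) ℓp<ℓq
    cutCondition⇒cut p q (q≡ , inj₂ (ℓp≡ℓq , ap<aq)) =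
      cutEq p q q≡ (ℓ p) (ℓ-longest p) (subst (Longest G π q) (sym ℓp≡ℓq) (ℓ-longest q)) ap<aq

  cut? : ∀ k → Dec (Cut G π k)
  cut? zero    = yes cut0
  cut? (suc m) with any? (λ p → (toℕ p ℕ.≟ m) ×-dec any? (cutCondition? p))
  ... | yes (p , refl , q , cond) = yes (cutCondition⇒cut p q cond)
  ... | no ¬cond = no λ where
    (cutLt p q q≡ r r′ Lp Lq r<r′) → ¬cond (p , refl , q , q≡ ,
       inj₁ (subst₂ _<_ (longest-unique Lp (ℓ-longest p)) (longest-unique Lq (ℓ-longest q)) r<r′))
    (cutEq p q q≡ r Lp Lq ap<aq) → ¬cond (p , refl , q , q≡ ,
       inj₂ (trans (longest-unique (ℓ-longest p) Lp) (longest-unique Lq (ℓ-longest q)) , ap<aq))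

  cut<d : ∀ {k} → Cut G π k → k < d
  cut<d cut0                       = s≤s z≤n
  cut<d (cutLt p q q≡ _ _ _ _ _) = subst (_< d) q≡ (toℕ<n q)
  cut<d (cutEq p q q≡ _ _ _ _)   = subst (_< d) q≡ (toℕ<n q)

  innerCuts : List ℕ
  innerCuts = filter cut? (applyUpTo suc d′)

  cuts-sorted : AllPairs _<_ (0 ∷ innerCuts)
  cuts-sorted = AllPairsₚ.filter⁺ cut? (AllPairsₚ.applyUpTo⁺₁ id d (λ i<j _ → i<j))

  cuts-isCutList : IsCutList G π (0 ∷ innerCuts)
  cuts-isCutList = (innerCuts , refl) , AllPairs⇒Linked cuts-sorted ,
                   (λ k cut → Memₚ.∈-filter⁺ cut? (Memₚ.∈-upTo⁺ (cut<d cut)) cut) ,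
                   Allₚ.all-filter cut? (upTo d)

  private
    inRange : ℕ → ℕ → Fin d → Bool
    inRange lo hi p = (lo ℕ.≤ᵇ toℕ p) ∧ (toℕ p ℕ.<ᵇ hi)

  ∈-block⁻ : ∀ lo hi p → a p ∈ block G π lo hi → lo ≤ toℕ p × toℕ p < hi
  ∈-block⁻ lo hi p ap∈ with find (Anyₚ.map⁻ (∈-⋃⁻ _ ap∈))
  ... | p′ , p′∈ , ap∈⁅ap′⁆ with letter-injective {p} {p′} (x∈⁅y⁆⇒x≡y (a p′) ap∈⁅ap′⁆)
  ... | refl = let lo≤p , p<hi = Equivalence.to T-∧ (proj₂ (Memₚ.∈-filter⁻ (T? ∘ inRange lo hi) {xs = List.allFin d} p′∈))
               in ℕₚ.≤ᵇ⇒≤ lo (toℕ p) lo≤p , ℕₚ.<ᵇ⇒< (toℕ p) hi p<hi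

  ∈-block⁺ : ∀ lo hi p → lo ≤ toℕ p → toℕ p < hi → a p ∈ block G π lo hi
  ∈-block⁺ lo hi p lo≤p p<hi = ∈-⋃⁺ _ (Anyₚ.map⁺ (lose p∈ (x∈⁅x⁆ (a p))))
    where
    p∈ : p ∈ˡ filterᵇ (inRange lo hi) (List.allFin d)
    p∈ = Memₚ.∈-filter⁺ (T? ∘ inRange lo hi) (Memₚ.∈-allFin p) (Equivalence.from T-∧ (ℕₚ.≤⇒≤ᵇ lo≤p , ℕₚ.<⇒<ᵇ p<hi))

  prefix : ℕ → Subset d
  prefix c = block G π 0 c

  ∈-prefix⁻ : ∀ c p → a p ∈ prefix c → toℕ p < c
  ∈-prefix⁻ c p = proj₂ ∘ ∈-block⁻ 0 c p

  ∈-prefix⁺ : ∀ c p → toℕ p < c → a p ∈ prefix c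
  ∈-prefix⁺ c p = ∈-block⁺ 0 c p z≤n

  via-position : ∀ {S : Subset d} x → a (position x) ∈ S → x ∈ S
  via-position {S} x = subst (_∈ S) (letter-position x)

  to-position : ∀ {S : Subset d} x → x ∈ S → a (position x) ∈ S
  to-position {S} x = subst (_∈ S) (sym (letter-position x))

  prefix0-⊆ : ∀ {S} → prefix 0 ⊆ S
  prefix0-⊆ {x = x} x∈ = contradiction (∈-prefix⁻ 0 (position x) (to-position x x∈)) ℕₚ.n≮0

  prefix0≡⊥ : prefix 0 ≡ Sub.⊥
  prefix0≡⊥ = ⊆-antisym prefix0-⊆ (⊆-min _)

  prefix-⊆ : ∀ {c c′} → c ≤ c′ → prefix c ⊆ prefix c′
  prefix-⊆ {c} {c′} c≤c′ {x} x∈ = via-position x (∈-prefix⁺ c′ (position x) (ℕₚ.<-≤-trans (∈-prefix⁻ c (position x) (to-position x x∈)) c≤c′))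

  prefix-─ : ∀ {c c′} → c ≤ c′ → prefix c′ ─ prefix c ≡ block G π c c′
  prefix-─ {c} {c′} c≤c′ = ⊆-antisym sub sup
    where
    sub : prefix c′ ─ prefix c ⊆ block G π c c′
    sub {x} x∈ = via-position x (∈-block⁺ c c′ p (ℕₚ.≮⇒≥ p≮c) p<c′)
      where
      p = position x
      p<c′ = ∈-prefix⁻ c′ p (to-position x (p─q⊆p _ _ x∈))
      p≮c = λ p<c → x∈p─q⇒x∉q _ _ x∈ (via-position x (∈-prefix⁺ c p p<c))
    sup : block G π c c′ ⊆ prefix c′ ─ prefix c
    sup {x} x∈ = x∈p∧x∉q⇒x∈p─q (via-position x (∈-prefix⁺ c′ p p<c′))
                             (λ x∈c → ℕₚ.<⇒≱ (∈-prefix⁻ c p (to-position x x∈c)) c≤p)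
      where
      p = position x
      c≤p = proj₁ (∈-block⁻ c c′ p (to-position x x∈))
      p<c′ = proj₂ (∈-block⁻ c c′ p (to-position x x∈))

  prefix-InBhat : ∀ {c} → 0 < c → c < d → InBhat (prefix c)
  prefix-InBhat {c} 0<c c<d =
    (a Fin.zero , ∈-prefix⁺ c Fin.zero 0<c) ,
    (a (fromℕ< c<d) , λ ac∈ → ℕₚ.<-irrefl (toℕ-fromℕ< c<d) (∈-prefix⁻ c (fromℕ< c<d) ac∈))

  prefix-⊂ : ∀ {c c′} → c < c′ → c < d → prefix c ⊂ prefix c′
  prefix-⊂ {c} {c′} c<c′ c<d =
    prefix-⊆ (ℕₚ.<⇒≤ c<c′) ,
    a (fromℕ< c<d) , ∈-prefix⁺ c′ (fromℕ< c<d) (subst (_< c′) (sym (toℕ-fromℕ< c<d)) c<c′) ,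
    λ ac∈ → ℕₚ.<-irrefl (toℕ-fromℕ< c<d) (∈-prefix⁻ c (fromℕ< c<d) ac∈)

  diffs-prefixes : ∀ {c rs} → AllPairs _<_ (c ∷ rs) → diffsFrom (prefix c) (map prefix rs) ≡ shortGSeq G π (c ∷ rs)
  diffs-prefixes {rs = []}      _                     = refl
  diffs-prefixes {rs = c′ ∷ rs} ((c<c′ ∷ _) ∷ sorted) = cong₂ _∷_ (prefix-─ (ℕₚ.<⇒≤ c<c′)) (diffs-prefixes sorted)

  diffs≡⇒prefixes : ∀ {c rs B} → AllPairs _<_ (c ∷ rs) → Linked _⊆_ (prefix c ∷ B) →
                    diffsFrom (prefix c) B ≡ shortGSeq G π (c ∷ rs) → B ≡ map prefix rs
  diffs≡⇒prefixes {rs = []}      {[]}    _ _ _ = refl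
  diffs≡⇒prefixes {c} {c′ ∷ rs} {S ∷ B} ((c<c′ ∷ _) ∷ sorted) (c⊆S ∷ S⊆B) eq =
    cong₂ _∷_ S≡ (diffs≡⇒prefixes sorted (subst (λ X → Linked _⊆_ (X ∷ B)) S≡ S⊆B)
                                     (subst (λ X → diffsFrom X B ≡ _) S≡ (Listₚ.∷-injectiveʳ eq)))
    where
    S≡ : S ≡ prefix c′
    S≡ = ─-cancelʳ c⊆S (prefix-⊆ (ℕₚ.<⇒≤ c<c′)) (trans (Listₚ.∷-injectiveˡ eq) (sym (prefix-─ (ℕₚ.<⇒≤ c<c′))))
  diffs≡⇒prefixes {rs = []}    {_ ∷ _} _ _ ()
  diffs≡⇒prefixes {rs = _ ∷ _} {[]}    _ _ ()

  prefixes-basicChain : BasicChain G (map prefix innerCuts)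
  prefixes-basicChain =
    AllPairs⇒Linked (AllPairsₚ.map⁺ (allPairs-mapWithAll (λ c<d _ c<c′ → prefix-⊂ c<c′ c<d) inner<d (AllPairs.tail cuts-sorted))) ,
    Allₚ.map⁺ (All.zipWith (λ (0<c , c<d) → prefix-InBhat 0<c c<d) (AllPairs.head cuts-sorted , inner<d)) ,
    π , 0 ∷ innerCuts , cuts-isCutList ,
    trans (cong (λ S → diffsFrom S (map prefix innerCuts)) (sym prefix0≡⊥)) (diffs-prefixes cuts-sorted)
    where
    inner<d : All (_< d) innerCuts
    inner<d = All.map cut<d (Allₚ.all-filter cut? (applyUpTo suc d′))

  cutPrefix-between : ∀ {rs} → IsCutList G π (0 ∷ rs) → ∀ x y → toℕ (position x) < toℕ (position y) →
                      adj G x y ≡ true → ∃ λ S → S ∈ˡ map prefix rs × x ∈ S × y ∉ S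
  cutPrefix-between (_ , _ , complete , _) x y px<py xy
    with cut-between (position x) (position y) px<py
           (subst₂ (λ u v → adj G u v ≡ true) (sym (letter-position x)) (sym (letter-position y)) xy)
  ... | k , cut , px<k , k≤py with complete k cut
  ...   | here refl  = contradiction px<k ℕₚ.n≮0
  ...   | there k∈rs = prefix k , Memₚ.∈-map⁺ prefix k∈rs , via-position x (∈-prefix⁺ k (position x) px<k) ,
                       λ y∈ → ℕₚ.<⇒≱ (∈-prefix⁻ k (position y) (to-position y y∈)) k≤py

  cutPrefixes-split : ∀ {rs} → IsCutList G π (0 ∷ rs) → ∀ x y → adj G x y ≡ true →
                      ∃ λ S → S ∈ˡ map prefix rs × Splits S x y
  cutPrefixes-split cuts x y xy with ℕₚ.<-cmp (toℕ (position x)) (toℕ (position y))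
  ... | tri< px<py _ _ = let S , S∈ , x∈S , y∉S = cutPrefix-between cuts x y px<py xy in S , S∈ , inj₁ (x∈S , y∉S)
  ... | tri> _ _ py<px = let S , S∈ , y∈S , x∉S = cutPrefix-between cuts y x py<px (trans (SimpleGraph.sym G y x) xy)
                         in S , S∈ , inj₂ (y∈S , x∉S)
  ... | tri≈ _ px≡py _ = contradiction (trans (sym (letter-position x)) (trans (cong a (toℕ-injective px≡py)) (letter-position y)))
                                       (adj-irreflexive G xy)

basicChain-splits : ∀ {d′} {G : SimpleGraph (suc d′)} {B} → BasicChain G B →
                    ∀ x y → adj G x y ≡ true → ∃ λ S → S ∈ˡ B × Splits S x y
basicChain-splits {G = G} {B} (B⊂ , _ , π , _ , isCutList@((rs , refl) , sorted , _) , eq) x y xy =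
  subst (λ B → ∃ λ S → S ∈ˡ B × Splits S x y) (sym B≡) (cutPrefixes-split isCutList x y xy)
  where
  open Cuts G π
  prefix0∷B : Linked _⊆_ (prefix 0 ∷ B)
  prefix0∷B with Linked.map proj₁ B⊂
  ... | []          = [-]
  ... | B⊆@[-]      = prefix0-⊆ ∷ B⊆
  ... | B⊆@(_ ∷ _)  = prefix0-⊆ ∷ B⊆
  B≡ : B ≡ map prefix rs
  B≡ = diffs≡⇒prefixes (Linked⇒AllPairs ℕₚ.<-trans sorted) prefix0∷B
         (trans (cong (λ S → diffsFrom S B) prefix0≡⊥) eq)

-- Faces of the coloring complex

injective⇒surjective : {f : Fin n → Fin n} → (∀ {x y} → f x ≡ f y → x ≡ y) → ∀ y → ∃ λ x → f x ≡ y
injective⇒surjective {n = suc n} {f} f-injective y with any? (λ x → f x Fin.≟ y)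
... | yes hit = hit
... | no miss = contradiction (λ {x} {x′} → g-injective {x} {x′}) (Finₚ.<⇒notInjective (ℕₚ.n<1+n n))
  where
  g : Fin (suc n) → Fin n
  g x = punchOut {i = y} {j = f x} (λ y≡fx → miss (x , sym y≡fx))
  g-injective : ∀ {x x′} → g x ≡ g x′ → x ≡ x′
  g-injective {x} {x′} = f-injective ∘ Finₚ.punchOut-injective {i = y} (λ y≡fx → miss (x , sym y≡fx)) (λ y≡fx′ → miss (x′ , sym y≡fx′))

module Ranking {n : ℕ} (_≺_ : Fin n → Fin n → Set) (_≺?_ : ∀ x y → Dec (x ≺ y))
               (≺-trans : ∀ {x y z} → x ≺ y → y ≺ z → x ≺ z) (≺-irrefl : ∀ {x} → ¬ x ≺ x)
               (≺-connex : ∀ {x y} → x ≢ y → x ≺ y ⊎ y ≺ x) where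

  opaque
    private
      predecessors : Fin n → Subset n
      predecessors z = tabulate (λ u → does (u ≺? z))

      ∈-predecessors⁻ : ∀ {u z} → u ∈ predecessors z → u ≺ z
      ∈-predecessors⁻ {u} {z} u∈ with u ≺? z | ∈-tabulate⁻ (λ u → does (u ≺? z)) u∈
      ... | yes u≺z | _ = u≺z

      ∈-predecessors⁺ : ∀ {u z} → u ≺ z → u ∈ predecessors z
      ∈-predecessors⁺ {u} {z} u≺z = ∈-tabulate⁺ (λ u → does (u ≺? z)) (dec-true (u ≺? z) u≺z)

      predecessors-⊂ : ∀ {z w} → z ≺ w → predecessors z ⊂ predecessors w
      predecessors-⊂ {z} z≺w = (∈-predecessors⁺ ∘ (λ u≺z → ≺-trans u≺z z≺w) ∘ ∈-predecessors⁻) ,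
                               z , ∈-predecessors⁺ z≺w , ≺-irrefl ∘ ∈-predecessors⁻

      ∣predecessors∣<n : ∀ z → ∣ predecessors z ∣ < n
      ∣predecessors∣<n z = subst (∣ predecessors z ∣ <_) (Subₚ.∣⊤∣≡n n)
        (Subₚ.p⊂q⇒∣p∣<∣q∣ (const Subₚ.∈⊤ , z , Subₚ.∈⊤ , ≺-irrefl ∘ ∈-predecessors⁻))

    rank : Fin n → Fin n
    rank z = fromℕ< (∣predecessors∣<n z)

    rank-mono : ∀ {z w} → z ≺ w → rank z Fin.< rank w
    rank-mono {z} {w} z≺w = subst₂ _<_ (sym (toℕ-fromℕ< (∣predecessors∣<n z))) (sym (toℕ-fromℕ< (∣predecessors∣<n w)))
                                      (Subₚ.p⊂q⇒∣p∣<∣q∣ (predecessors-⊂ z≺w))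

    rank-reflects : ∀ {z w} → rank z Fin.< rank w → z ≺ w
    rank-reflects {z} {w} rz<rw with z Fin.≟ w
    ... | yes refl = contradiction rz<rw (ℕₚ.<-irrefl refl)
    ... | no z≢w   = [ id , (λ w≺z → contradiction rz<rw (ℕₚ.<-asym (rank-mono w≺z))) ]′ (≺-connex z≢w)

    rank-injective : ∀ {z w} → rank z ≡ rank w → z ≡ w
    rank-injective {z} {w} rz≡rw with z Fin.≟ w
    ... | yes z≡w = z≡w
    ... | no z≢w  = contradiction rz≡rw ([ Finₚ.<⇒≢ ∘ rank-mono , (λ w≺z → Finₚ.<⇒≢ (rank-mono w≺z) ∘ sym) ]′ (≺-connex z≢w))

    unrank : Fin n → Fin n
    unrank p = proj₁ (injective⇒surjective rank-injective p)

    rank-unrank : ∀ p → rank (unrank p) ≡ p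
    rank-unrank p = proj₂ (injective⇒surjective rank-injective p)

    unrank-rank : ∀ z → unrank (rank z) ≡ z
    unrank-rank z = rank-injective (rank-unrank (rank z))

  ranking : Permutation′ n
  ranking = permutation unrank rank unrank-rank rank-unrank

chain-minimal : {x : Fin n} {σ : List (Subset n)} → AllPairs Comparable σ → Any (x ∈_) σ →
                ∃ λ S → S ∈ˡ σ × x ∈ S × (∀ {T} → T ∈ˡ σ → x ∈ T → S ⊆ T)
chain-minimal {x = x} {T ∷ σ} (T≷ ∷ σ≷) x∈T∷σ with Any.any? (x ∈?_) σ
... | no x∉σ = T , here refl , x∈T , T-min
  where
  x∈T : x ∈ T
  x∈T = [ id , (λ x∈σ → contradiction x∈σ x∉σ) ]′ (Any.toSum x∈T∷σ)
  T-min : ∀ {T′} → T′ ∈ˡ (T ∷ σ) → x ∈ T′ → T ⊆ T′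
  T-min (here refl) _      = id
  T-min (there T′∈) x∈T′ = contradiction (lose T′∈ x∈T′) x∉σ
... | yes x∈σ with chain-minimal σ≷ x∈σ
...   | S , S∈ , x∈S , S-min with x ∈? T | All.lookup T≷ S∈
...     | yes x∈T | inj₁ T⊆S = T , here refl , x∈T , λ { (here refl) _ → id ; (there T′∈) x∈T′ → ⊆-trans T⊆S (S-min T′∈ x∈T′) }
...     | yes _   | inj₂ S⊆T = S , there S∈ , x∈S , λ { (here refl) _ → S⊆T ; (there T′∈) → S-min T′∈ }
...     | no x∉T  | _        = S , there S∈ , x∈S , λ { (here refl) x∈T → contradiction x∈T x∉T ; (there T′∈) → S-min T′∈ }

_⊏_ : ℕ × ℕ × ℕ → ℕ × ℕ × ℕ → Set
(a , b , c) ⊏ (a′ , b′ , c′) = a < a′ ⊎ (a ≡ a′ × (b′ < b ⊎ (b ≡ b′ × c′ < c)))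

_⊏?_ : ∀ t t′ → Dec (t ⊏ t′)
(a , b , c) ⊏? (a′ , b′ , c′) = (a ℕ.<? a′) ⊎-dec ((a ℕ.≟ a′) ×-dec ((b′ ℕ.<? b) ⊎-dec ((b ℕ.≟ b′) ×-dec (c′ ℕ.<? c))))

⊏-trans : ∀ {t t′ t″} → t ⊏ t′ → t′ ⊏ t″ → t ⊏ t″
⊏-trans (inj₁ a<a′)       (inj₁ a′<a″)       = inj₁ (ℕₚ.<-trans a<a′ a′<a″)
⊏-trans (inj₁ a<a′)       (inj₂ (refl , _))  = inj₁ a<a′
⊏-trans (inj₂ (refl , _)) (inj₁ a′<a″)       = inj₁ a′<a″
⊏-trans (inj₂ (refl , s)) (inj₂ (refl , s′)) = inj₂ (refl , trans′ s s′)
  where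
  trans′ : ∀ {b b′ b″ c c′ c″} → b′ < b ⊎ (b ≡ b′ × c′ < c) → b″ < b′ ⊎ (b′ ≡ b″ × c″ < c′) →
           b″ < b ⊎ (b ≡ b″ × c″ < c)
  trans′ (inj₁ b′<b)        (inj₁ b″<b′)        = inj₁ (ℕₚ.<-trans b″<b′ b′<b)
  trans′ (inj₁ b′<b)        (inj₂ (refl , _))    = inj₁ b′<b
  trans′ (inj₂ (refl , _))  (inj₁ b″<b′)        = inj₁ b″<b′
  trans′ (inj₂ (refl , c′<c)) (inj₂ (refl , c″<c′)) = inj₂ (refl , ℕₚ.<-trans c″<c′ c′<c)

⊏-irrefl : ∀ {t} → ¬ t ⊏ t
⊏-irrefl (inj₁ a<a)                = ℕₚ.<-irrefl refl a<a
⊏-irrefl (inj₂ (_ , inj₁ b<b))      = ℕₚ.<-irrefl refl b<b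
⊏-irrefl (inj₂ (_ , inj₂ (_ , c<c))) = ℕₚ.<-irrefl refl c<c

⊏-connex : ∀ {a b c a′ b′ c′} → c ≢ c′ → (a , b , c) ⊏ (a′ , b′ , c′) ⊎ (a′ , b′ , c′) ⊏ (a , b , c)
⊏-connex {a} {b} {c} {a′} {b′} {c′} c≢c′ with ℕₚ.<-cmp a a′ | ℕₚ.<-cmp b b′ | ℕₚ.<-cmp c c′
... | tri< a<a′ _ _ | _             | _             = inj₁ (inj₁ a<a′)
... | tri> _ _ a′<a | _             | _             = inj₂ (inj₁ a′<a)
... | tri≈ _ refl _ | tri< b<b′ _ _ | _             = inj₂ (inj₂ (refl , inj₁ b<b′))
... | tri≈ _ refl _ | tri> _ _ b′<b | _             = inj₁ (inj₂ (refl , inj₁ b′<b))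
... | tri≈ _ refl _ | tri≈ _ refl _ | tri< c<c′ _ _ = inj₂ (inj₂ (refl , inj₂ (refl , c<c′)))
... | tri≈ _ refl _ | tri≈ _ refl _ | tri> _ _ c′<c = inj₁ (inj₂ (refl , inj₂ (refl , c′<c)))
... | tri≈ _ refl _ | tri≈ _ refl _ | tri≈ _ c≡c′ _ = contradiction c≡c′ c≢c′

module SplittingChain {d′ : ℕ} (G : SimpleGraph (suc d′)) (σ : List (Subset (suc d′)))
                      (σ-chain : AllPairs Comparable σ)
                      (splitsAll : ∀ x y → adj G x y ≡ true → ∃ λ S → S ∈ˡ σ × Splits S x y) where

  private
    d : ℕ
    d = suc d′

  opaque
    depth : Fin d → ℕ
    depth x = length (filter (λ T → ¬? (x ∈? T)) σ)

    depth-< : ∀ {S x y} → S ∈ˡ σ → x ∈ S → y ∉ S → depth x < depth y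
    depth-< {S} {x} {y} S∈ x∈S y∉S =
      length-filter-strictMono (λ T → ¬? (x ∈? T)) (λ T → ¬? (y ∈? T)) σ x∉⇒y∉ (S , S∈ , y∉S , λ x∉S → x∉S x∈S)
      where
      x∉⇒y∉ : ∀ {T} → T ∈ˡ σ → x ∉ T → y ∉ T
      x∉⇒y∉ T∈ x∉T y∈T with comparable-∈ σ-chain T∈ S∈
      ... | inj₁ T⊆S = y∉S (T⊆S y∈T)
      ... | inj₂ S⊆T = x∉T (S⊆T x∈S)

    depth-≢ : ∀ {x y} → adj G x y ≡ true → depth x ≢ depth y
    depth-≢ {x} {y} xy with splitsAll x y xy
    ... | S , S∈ , inj₁ (x∈S , y∉S) = ℕₚ.<⇒≢ (depth-< S∈ x∈S y∉S)
    ... | S , S∈ , inj₂ (y∈S , x∉S) = ℕₚ.<⇒≢ (depth-< S∈ y∈S x∉S) ∘ sym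

    depth≤ : ∀ x → depth x ≤ length σ
    depth≤ x = Listₚ.length-filter (λ T → ¬? (x ∈? T)) σ

    depth<⇒∈ : ∀ {x} → depth x < length σ → Any (x ∈_) σ
    depth<⇒∈ {x} lt with length-filter<⇒∃¬ (λ T → ¬? (x ∈? T)) σ lt
    ... | T , T∈ , ¬x∉T = lose T∈ (decidable-stable (x ∈? T) ¬x∉T)

    depth-mono : ∀ {z x} → (∀ {T} → T ∈ˡ σ → z ∉ T → x ∉ T) → depth z ≤ depth x
    depth-mono {z} {x} = length-filter-mono (λ T → ¬? (z ∈? T)) (λ T → ¬? (x ∈? T)) σ

  DeeperNeighbour : Fin d → Fin d → Set
  DeeperNeighbour y x = depth y < depth x × adj G y x ≡ true

  deeperNeighbour? : ∀ y x → Dec (DeeperNeighbour y x)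
  deeperNeighbour? y x = (depth y ℕ.<? depth x) ×-dec (adj G y x Bool.≟ true)

  open Height DeeperNeighbour deeperNeighbour? depth proj₁ using (height; height-isHeight)

  opaque
    reach : Fin d → ℕ
    reach = height (length σ) depth≤

    reach-isHeight : ∀ x → (∀ y → DeeperNeighbour y x → reach y < reach x) ×
                           (reach x ≡ 0 ⊎ ∃ λ y → DeeperNeighbour y x × reach x ≡ suc (reach y))
    reach-isHeight = height-isHeight (length σ) depth≤

  -- Listing the vertices by depth makes every cut a rise in depth: within one depth,
  -- decreasing reach and decreasing label leave no room for a cut.
  key : Fin d → ℕ × ℕ × ℕ
  key z = depth z , reach z , toℕ z

  _≺_ : Fin d → Fin d → Set
  z ≺ w = key z ⊏ key w

  _≺?_ : ∀ z w → Dec (z ≺ w)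
  z ≺? w = key z ⊏? key w

  ≺-connex : ∀ {z w} → z ≢ w → z ≺ w ⊎ w ≺ z
  ≺-connex z≢w = ⊏-connex (z≢w ∘ toℕ-injective)

  open Ranking _≺_ _≺?_ ⊏-trans ⊏-irrefl ≺-connex
  open Cuts G ranking

  private
    ≺⇒depth≤ : ∀ {z w} → z ≺ w → depth z ≤ depth w
    ≺⇒depth≤ (inj₁ dz<dw)     = ℕₚ.<⇒≤ dz<dw
    ≺⇒depth≤ (inj₂ (dz≡dw , _)) = ℕₚ.≤-reflexive dz≡dw

    rank≤⇒depth≤ : ∀ {z w} → toℕ (rank z) ≤ toℕ (rank w) → depth z ≤ depth w
    rank≤⇒depth≤ rz≤rw with ℕₚ.m≤n⇒m<n∨m≡n rz≤rw
    ... | inj₁ rz<rw = ≺⇒depth≤ (rank-reflects rz<rw)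
    ... | inj₂ rz≡rw = ℕₚ.≤-reflexive (cong depth (rank-injective (toℕ-injective rz≡rw)))

    earlier⇒≺ : ∀ {i p} → i Fin.< p → unrank i ≺ unrank p
    earlier⇒≺ {i} {p} i<p = rank-reflects (subst₂ Fin._<_ (sym (rank-unrank i)) (sym (rank-unrank p)) i<p)

  reach-unrank-isHeight : IsHeight (reach ∘ unrank)
  reach-unrank-isHeight p = increasing , attained
    where
    x = unrank p
    increasing : ∀ i → EarlierNeighbour i p → reach (unrank i) < reach x
    increasing i (i<p , ix) = proj₁ (reach-isHeight x) (unrank i) (deeper (earlier⇒≺ i<p) , ix)
      where
      deeper : unrank i ≺ x → depth (unrank i) < depth x
      deeper (inj₁ di<dx)     = di<dx
      deeper (inj₂ (di≡dx , _)) = contradiction di≡dx (depth-≢ ix)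
    attained : reach x ≡ 0 ⊎ ∃ λ i → EarlierNeighbour i p × reach x ≡ suc (reach (unrank i))
    attained with proj₂ (reach-isHeight x)
    ... | inj₁ reach≡0 = inj₁ reach≡0
    ... | inj₂ (y , (dy<dx , yx) , reach≡) =
      inj₂ (rank y , (subst (λ q → rank y Fin.< q) (rank-unrank p) (rank-mono (inj₁ dy<dx)) , yx′) , reach≡′)
      where
      yx′ : adj G (unrank (rank y)) x ≡ true
      yx′ = subst (λ z → adj G z x ≡ true) (sym (unrank-rank y)) yx
      reach≡′ : reach x ≡ suc (reach (unrank (rank y)))
      reach≡′ = trans reach≡ (cong (suc ∘ reach) (sym (unrank-rank y)))

  private
    longest≡reach : ∀ {p r} → Longest G ranking p r → r ≡ reach (unrank p)
    longest≡reach {p} Lp = longest-unique Lp (isHeight⇒longest reach-unrank-isHeight p)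

    cut⇒depth< : ∀ p q → toℕ q ≡ suc (toℕ p) →
                 reach (unrank p) < reach (unrank q) ⊎ (reach (unrank p) ≡ reach (unrank q) × unrank p Fin.< unrank q) →
                 depth (unrank p) < depth (unrank q)
    cut⇒depth< p q q≡ cond with earlier⇒≺ {p} {q} (subst (toℕ p <_) (sym q≡) (ℕₚ.n<1+n (toℕ p))) | cond
    ... | inj₁ dp<dq                       | _                      = dp<dq
    ... | inj₂ (_ , inj₁ rq<rp)            | inj₁ rp<rq             = contradiction rq<rp (ℕₚ.<-asym rp<rq)
    ... | inj₂ (_ , inj₁ rq<rp)            | inj₂ (rp≡rq , _)       = contradiction (sym rp≡rq) (ℕₚ.<⇒≢ rq<rp)
    ... | inj₂ (_ , inj₂ (rp≡rq , _))      | inj₁ rp<rq             = contradiction rp≡rq (ℕₚ.<⇒≢ rp<rq)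
    ... | inj₂ (_ , inj₂ (_ , tq<tp))      | inj₂ (_ , tp<tq)       = contradiction tq<tp (ℕₚ.<-asym tp<tq)

    -- the prefix ending just before a rise in depth is the least member of σ containing its last letter
    prefix∈σ : ∀ p q → toℕ q ≡ suc (toℕ p) → depth (unrank p) < depth (unrank q) → prefix (suc (toℕ p)) ∈ˡ σ
    prefix∈σ p q q≡ dx<dy = subst (_∈ˡ σ) (⊆-antisym S⊆prefix prefix⊆S) S∈
      where
      x = unrank p
      y = unrank q
      minimal = chain-minimal σ-chain (depth<⇒∈ (ℕₚ.<-≤-trans dx<dy (depth≤ y)))
      S = proj₁ minimal
      S∈ = proj₁ (proj₂ minimal)
      x∈S = proj₁ (proj₂ (proj₂ minimal))
      S-min = proj₂ (proj₂ (proj₂ minimal))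
      prefix⊆S : prefix (suc (toℕ p)) ⊆ S
      prefix⊆S {z} z∈ with z ∈? S
      ... | yes z∈S = z∈S
      ... | no z∉S  = contradiction (depth-< S∈ x∈S z∉S) (ℕₚ.≤⇒≯ (rank≤⇒depth≤ rz≤rx))
        where
        rz≤rx : toℕ (rank z) ≤ toℕ (rank x)
        rz≤rx = subst (λ r → toℕ (rank z) ≤ toℕ r) (sym (rank-unrank p))
                  (ℕₚ.≤-pred (∈-prefix⁻ (suc (toℕ p)) (position z) (to-position z z∈)))
      S⊆prefix : S ⊆ prefix (suc (toℕ p))
      S⊆prefix {z} z∈S = via-position z (∈-prefix⁺ (suc (toℕ p)) (position z) (s≤s (ℕₚ.≮⇒≥ p≮rz)))
        where
        dz≤dx : depth z ≤ depth x
        dz≤dx = depth-mono (λ T∈ z∉T x∈T → z∉T (S-min T∈ x∈T z∈S))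
        p≮rz : ¬ toℕ p < toℕ (rank z)
        p≮rz p<rz = ℕₚ.<⇒≱ dx<dy (ℕₚ.≤-trans (rank≤⇒depth≤ ry≤rz) dz≤dx)
          where
          ry≤rz : toℕ (rank y) ≤ toℕ (rank z)
          ry≤rz = subst (λ r → toℕ r ≤ toℕ (rank z)) (sym (rank-unrank q)) (subst (_≤ toℕ (rank z)) (sym q≡) p<rz)

    cut⇒prefix∈σ : ∀ {k} → Cut G ranking k → 0 < k → prefix k ∈ˡ σ
    cut⇒prefix∈σ (cutLt p q q≡ r r′ Lp Lq r<r′) _ =
      prefix∈σ p q q≡ (cut⇒depth< p q q≡ (inj₁ (subst₂ _<_ (longest≡reach Lp) (longest≡reach Lq) r<r′)))
    cut⇒prefix∈σ (cutEq p q q≡ r Lp Lq ap<aq) _ =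
      prefix∈σ p q q≡ (cut⇒depth< p q q≡ (inj₂ (trans (sym (longest≡reach Lp)) (longest≡reach Lq) , ap<aq)))

  contains-basicChain : ∃ λ B → BasicChain G B × B ⊆ˡ σ
  contains-basicChain = map prefix innerCuts , prefixes-basicChain ,
    Allₚ.map⁺ (All.zipWith (λ (0<c , cut) → cut⇒prefix∈σ cut 0<c)
                           (AllPairs.head cuts-sorted , Allₚ.all-filter cut? (applyUpTo suc d′)))

module _ {d′ : ℕ} {G : SimpleGraph (suc d′)} where

  unsplitEdge⇒face : ∀ {σ} → OCFace (suc d′) σ → (e : Edge G) → All (EdgeUnsplit e) σ → Face G σ
  unsplitEdge⇒face σ-face e σ-unsplit = σ-face , λ B B-basic B⊆σ →
    let S , S∈B , splits = basicChain-splits B-basic (ei e) (ej e) (isE e)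
    in unsplit⇒¬splits (All.lookup σ-unsplit (All.lookup B⊆σ S∈B)) splits

  private
    unsplitEdge? : ∀ σ x y → Dec (x Fin.< y × adj G x y ≡ true × All (λ S → Unsplit S x y) σ)
    unsplitEdge? σ x y = (x Finₚ.<? y) ×-dec ((adj G x y Bool.≟ true) ×-dec all? (λ S → unsplit? S x y) σ)

  face⇒unsplitEdge : ∀ {σ} → Face G σ → Σ (Edge G) λ e → All (EdgeUnsplit e) σ
  face⇒unsplitEdge {σ} ((_ , σ-chain) , noBasicChain) with any? (λ x → any? (unsplitEdge? σ x))
  ... | yes (x , y , x<y , xy , σ-unsplit) = edge x y x<y xy , σ-unsplit
  ... | no noUnsplitEdge = contradiction B⊆σ (noBasicChain B B-basic)
    where
    split : ∀ x y → ¬ All (λ S → Unsplit S x y) σ → ∃ λ S → S ∈ˡ σ × Splits S x y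
    split x y = Product.map₂ (Product.map₂ ¬unsplit⇒splits) ∘ find ∘ Allₚ.¬All⇒Any¬ (λ S → unsplit? S x y) σ
    splitsAll : ∀ x y → adj G x y ≡ true → ∃ λ S → S ∈ˡ σ × Splits S x y
    splitsAll x y xy with ℕₚ.<-cmp (toℕ x) (toℕ y)
    ... | tri< x<y _ _ = split x y (λ σ-unsplit → noUnsplitEdge (x , y , x<y , xy , σ-unsplit))
    ... | tri> _ _ y<x = Product.map₂ (Product.map₂ splits-sym)
                           (split y x (λ σ-unsplit → noUnsplitEdge (y , x , y<x , trans (SimpleGraph.sym G y x) xy , σ-unsplit)))
    ... | tri≈ _ x≡y _ = contradiction (toℕ-injective x≡y) (adj-irreflexive G xy)
    open SplittingChain G σ σ-chain splitsAll using (contains-basicChain)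
    B = proj₁ contains-basicChain
    B-basic = proj₁ (proj₂ contains-basicChain)
    B⊆σ = proj₂ (proj₂ contains-basicChain)

  inSphere⇒face : ∀ {σ} (e : Edge G) → InSphere e σ → Face G σ
  inSphere⇒face e σ∈ = let σ-face , σ-unsplit = EdgeSphere.inSphere⇒unsplitChain e σ∈ in unsplitEdge⇒face σ-face e σ-unsplit

  face⇒inSphere : ∀ {σ} → Face G σ → Σ (Edge G) λ e → InSphere e σ
  face⇒inSphere σ-face = let e , σ-unsplit = face⇒unsplitEdge σ-face
                         in e , EdgeSphere.unsplitChain⇒inSphere e (proj₁ σ-face) σ-unsplit

-- Isomorphisms with truncated Boolean algebras

preimage-∘ : {m k : ℕ} (f : Fin n → Fin m) (g : Fin m → Fin k) (W : Subset k) →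
             preimage (g ∘ f) W ≡ preimage f (preimage g W)
preimage-∘ f g W = ⊆-antisym (∈-preimage⁺ f _ ∘ ∈-preimage⁺ g W ∘ ∈-preimage⁻ (g ∘ f) W)
                             (∈-preimage⁺ (g ∘ f) W ∘ ∈-preimage⁻ g W ∘ ∈-preimage⁻ f _)

unsplit-preimage : {m : ℕ} (f : Fin n → Fin m) {W : Subset m} {x y : Fin n} →
                   Unsplit W (f x) (f y) → Unsplit (preimage f W) x y
unsplit-preimage f {W} (fx⇒fy , fy⇒fx) =
  ∈-preimage⁺ f W ∘ fx⇒fy ∘ ∈-preimage⁻ f W , ∈-preimage⁺ f W ∘ fy⇒fx ∘ ∈-preimage⁻ f W

-- S is a union of fibres of φ, which has the section ψ
Saturated : {m : ℕ} → (Fin n → Fin m) → (Fin m → Fin n) → Subset n → Set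
Saturated φ ψ S = ∀ x → (x ∈ S → ψ (φ x) ∈ S) × (ψ (φ x) ∈ S → x ∈ S)

saturated-∘ : {m k : ℕ} {φ₁ : Fin n → Fin m} {ψ₁ : Fin m → Fin n} {φ₂ : Fin m → Fin k} {ψ₂ : Fin k → Fin m}
              {S : Subset n} → Saturated φ₁ ψ₁ S → Saturated φ₂ ψ₂ (preimage ψ₁ S) →
              Saturated (φ₂ ∘ φ₁) (ψ₁ ∘ ψ₂) S
saturated-∘ {φ₁ = φ₁} {ψ₁} {φ₂} {ψ₂} {S} sat₁ sat₂ x =
  ∈-preimage⁻ ψ₁ S ∘ proj₁ (sat₂ (φ₁ x)) ∘ ∈-preimage⁺ ψ₁ S ∘ proj₁ (sat₁ x) ,
  proj₂ (sat₁ x) ∘ ∈-preimage⁻ ψ₁ S ∘ proj₂ (sat₂ (φ₁ x)) ∘ ∈-preimage⁺ ψ₁ S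

saturated⇒unsplit-image : {m : ℕ} {φ : Fin n → Fin m} {ψ : Fin m → Fin n} {S : Subset n} {x y : Fin n} →
                          Saturated φ ψ S → Unsplit S x y → Unsplit (preimage ψ S) (φ x) (φ y)
saturated⇒unsplit-image {φ = φ} {ψ} {S} {x} {y} sat (x⇒y , y⇒x) =
  ∈-preimage⁺ ψ S ∘ proj₁ (sat y) ∘ x⇒y ∘ proj₂ (sat x) ∘ ∈-preimage⁻ ψ S ,
  ∈-preimage⁺ ψ S ∘ proj₁ (sat x) ∘ y⇒x ∘ proj₂ (sat y) ∘ ∈-preimage⁻ ψ S

module SaturatedChainIso {m : ℕ} (K : List (Subset n) → Set) (P : Subset n → Set)
  (K⇒ : ∀ {σ} → K σ → OCFace n σ × All P σ) (K⇐ : ∀ {σ} → OCFace n σ → All P σ → K σ)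
  (φ : Fin n → Fin m) (ψ : Fin m → Fin n) (φψ : ∀ c → φ (ψ c) ≡ c)
  (P⇒saturated : ∀ {S} → P S → Saturated φ ψ S) (P-preimage : ∀ W → P (preimage φ W)) where

  private
    ψ-InBhat : ∀ {S} → P S → InBhat S → InBhat (preimage ψ S)
    ψ-InBhat {S} PS ((x , x∈S) , (y , y∉S)) =
      (φ x , ∈-preimage⁺ ψ S (proj₁ (P⇒saturated PS x) x∈S)) ,
      (φ y , y∉S ∘ proj₂ (P⇒saturated PS y) ∘ ∈-preimage⁻ ψ S)

    φ-InBhat : ∀ {W} → InBhat W → InBhat (preimage φ W)
    φ-InBhat {W} ((c , c∈W) , (c′ , c′∉W)) =
      (ψ c , ∈-preimage⁺ φ W (subst (_∈ W) (sym (φψ c)) c∈W)) ,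
      (ψ c′ , c′∉W ∘ subst (_∈ W) (φψ c′) ∘ ∈-preimage⁻ φ W)

  iso : SimplicialIso K (OCFace m)
  iso = record
    { to        = preimage ψ
    ; from      = preimage φ
    ; from-to   = λ S K[S] → let PS = All.head (proj₂ (K⇒ K[S])) in ⊆-antisym
                    (proj₂ (P⇒saturated PS _) ∘ ∈-preimage⁻ ψ S ∘ ∈-preimage⁻ φ (preimage ψ S))
                    (∈-preimage⁺ φ (preimage ψ S) ∘ ∈-preimage⁺ ψ S ∘ proj₁ (P⇒saturated PS _))
    ; to-from   = λ W _ → ⊆-antisym
                    (subst (_∈ W) (φψ _) ∘ ∈-preimage⁻ φ W ∘ ∈-preimage⁻ ψ (preimage φ W))
                    (∈-preimage⁺ ψ (preimage φ W) ∘ ∈-preimage⁺ φ W ∘ subst (_∈ W) (sym (φψ _)))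
    ; to-face   = λ σ K[σ] → let (σ-InBhat , σ-chain) , σ-P = K⇒ K[σ] in
                    Allₚ.map⁺ (All.zipWith (λ (S-InBhat , PS) → ψ-InBhat PS S-InBhat) (σ-InBhat , σ-P)) ,
                    AllPairsₚ.map⁺ (AllPairs.map (comparable-preimage ψ) σ-chain)
    ; from-face = λ τ (τ-InBhat , τ-chain) →
                    K⇐ (Allₚ.map⁺ (All.map φ-InBhat τ-InBhat) , AllPairsₚ.map⁺ (AllPairs.map (comparable-preimage φ) τ-chain))
                       (Allₚ.map⁺ (All.tabulate (λ {W} _ → P-preimage W)))
    }

-- φ identifies b with a; its section ψ misses b.
module Collapse {m : ℕ} (a b : Fin (suc m)) (a≢b : a ≢ b) where

  φ : Fin (suc m) → Fin m
  φ x with x Fin.≟ b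
  ... | yes _   = punchOut (a≢b ∘ sym)
  ... | no x≢b = punchOut (x≢b ∘ sym)

  ψ : Fin m → Fin (suc m)
  ψ = punchIn b

  φψ : ∀ c → φ (ψ c) ≡ c
  φψ c with punchIn b c Fin.≟ b
  ... | yes eq = contradiction eq (Finₚ.punchInᵢ≢i b c)
  ... | no _   = trans (Finₚ.punchOut-cong b refl) (Finₚ.punchOut-punchIn b)

  ψφ : ∀ x → ψ (φ x) ≡ x ⊎ (x ≡ b × ψ (φ x) ≡ a)
  ψφ x with x Fin.≟ b
  ... | yes x≡b = inj₂ (x≡b , Finₚ.punchIn-punchOut _)
  ... | no _    = inj₁ (Finₚ.punchIn-punchOut _)

  φa≡φb : φ a ≡ φ b
  φa≡φb with a Fin.≟ b | b Fin.≟ b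
  ... | yes a≡b | _       = contradiction a≡b a≢b
  ... | no _    | yes _   = Finₚ.punchOut-cong b refl
  ... | no _    | no b≢b = contradiction refl b≢b

  φ-identifies : ∀ {x y} → φ x ≡ φ y → x ≡ y ⊎ (x ≡ b × y ≡ a) ⊎ (x ≡ a × y ≡ b)
  φ-identifies {x} {y} φx≡φy with ψφ x | ψφ y
  ... | inj₁ ψφx≡x         | inj₁ ψφy≡y         = inj₁ (trans (sym ψφx≡x) (trans (cong ψ φx≡φy) ψφy≡y))
  ... | inj₂ (x≡b , _)      | inj₂ (y≡b , _)      = inj₁ (trans x≡b (sym y≡b))
  ... | inj₂ (x≡b , ψφx≡a) | inj₁ ψφy≡y         = inj₂ (inj₁ (x≡b , trans (sym ψφy≡y) (trans (cong ψ (sym φx≡φy)) ψφx≡a)))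
  ... | inj₁ ψφx≡x         | inj₂ (y≡b , ψφy≡a) = inj₂ (inj₂ (trans (sym ψφx≡x) (trans (cong ψ φx≡φy) ψφy≡a) , y≡b))

  unsplit⇒saturated : ∀ {S} → Unsplit S a b → Saturated φ ψ S
  unsplit⇒saturated {S} (a⇒b , b⇒a) x with ψφ x
  ... | inj₁ ψφx≡x        = subst (_∈ S) (sym ψφx≡x) , subst (_∈ S) ψφx≡x
  ... | inj₂ (refl , ψφb≡a) = subst (_∈ S) (sym ψφb≡a) ∘ b⇒a , a⇒b ∘ subst (_∈ S) ψφb≡a

  preimage-unsplit : ∀ W → Unsplit (preimage φ W) a b
  preimage-unsplit W = unsplit-preimage φ (subst (λ c → Unsplit W (φ a) c) φa≡φb (id , id))

-- Separation

module _ {d : ℕ} {G : SimpleGraph d} where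

  sameEdge? : (e f : Edge G) → Dec (SameEdge e f)
  sameEdge? e f = (ei e Fin.≟ ei f) ×-dec (ej e Fin.≟ ej f)

  ¬sameEdge⇒¬inEdge : (e f : Edge G) → ¬ SameEdge e f → ¬ (EdgeSphere.InEdge e (ei f) × EdgeSphere.InEdge e (ej f))
  ¬sameEdge⇒¬inEdge e f e≠f (inj₁ i≡a , inj₁ j≡a) = ei≢ej f (trans i≡a (sym j≡a))
  ¬sameEdge⇒¬inEdge e f e≠f (inj₂ i≡b , inj₂ j≡b) = ei≢ej f (trans i≡b (sym j≡b))
  ¬sameEdge⇒¬inEdge e f e≠f (inj₁ i≡a , inj₂ j≡b) = e≠f (sym i≡a , sym j≡b)
  ¬sameEdge⇒¬inEdge e f e≠f (inj₂ i≡b , inj₁ j≡a) = ℕₚ.<-asym (lt e) (subst₂ (λ u v → toℕ u < toℕ v) i≡b j≡a (lt f))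

  inSphere-⊆ : ∀ {e : Edge G} {σ τ} → InSphere e σ → τ ⊆ˡ σ → InSphere e τ
  inSphere-⊆ (w , p , σ⊆facet) τ⊆σ = w , p , All.map (All.lookup σ⊆facet) τ⊆σ

module Separating {d : ℕ} {G : SimpleGraph d} (e f : Edge G) (e≠f : ¬ SameEdge e f) where

  open Separation e f
  open EdgeSphere e using (InEdge; inSphere⇒unsplitChain; unsplitChain⇒inSphere)

  private
    i j : Fin d
    i = ei f
    j = ej f

  splitting-member : ∀ {σ} → InSphere e σ → ¬ InSphere f σ → ∃ λ T → T ∈ˡ σ × Splits T i j
  splitting-member {σ} σ∈e σ∉f with all? (λ S → unsplit? S i j) σ
  ... | yes σ-unsplit = contradiction (EdgeSphere.unsplitChain⇒inSphere f (proj₁ (inSphere⇒unsplitChain σ∈e)) σ-unsplit) σ∉f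
  ... | no ¬unsplit   = Product.map₂ (Product.map₂ ¬unsplit⇒splits) (find (Allₚ.¬All⇒Any¬ (λ S → unsplit? S i j) σ ¬unsplit))

  splitting⇒outside : ∀ {σ T} → InSphere e σ → T ∈ˡ σ → Splits T i j → Outside σ
  splitting⇒outside σ∈e T∈ splits = σ∈e , λ σ∈f → unsplit⇒¬splits (All.lookup (proj₂ (EdgeSphere.inSphere⇒unsplitChain f σ∈f)) T∈) splits

  vertex : ∀ x y → x ≢ y → ¬ (InEdge x × InEdge y) → ∃ λ v → InSphere e [ v ] × x ∈ v × y ∉ v
  vertex x y x≢y ¬xy∈e with (x Fin.≟ ei e) ⊎-dec (x Fin.≟ ej e)
  ... | yes x∈e = v , unsplitChain⇒inSphere (((x , x∈v) , (y , y∉v)) ∷ [] , [] ∷ []) (v-unsplit ∷ []) , x∈v , y∉v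
    where
    v = ⁅ ei e ⁆ ∪ ⁅ ej e ⁆
    x∈v : x ∈ v
    x∈v = [ (λ { refl → x∈p∪q⁺ (inj₁ (x∈⁅x⁆ x)) }) , (λ { refl → x∈p∪q⁺ (inj₂ (x∈⁅x⁆ x)) }) ]′ x∈e
    y∉v : y ∉ v
    y∉v y∈v = ¬xy∈e (x∈e , Sum.map (x∈⁅y⁆⇒x≡y _) (x∈⁅y⁆⇒x≡y _) (x∈p∪q⁻ ⁅ ei e ⁆ ⁅ ej e ⁆ y∈v))
    v-unsplit : EdgeUnsplit e v
    v-unsplit = const (x∈p∪q⁺ (inj₂ (x∈⁅x⁆ (ej e)))) , const (x∈p∪q⁺ (inj₁ (x∈⁅x⁆ (ei e))))
  ... | no x∉e = ⁅ x ⁆ , unsplitChain⇒inSphere (((x , x∈⁅x⁆ x) , (y , y∉⁅x⁆)) ∷ [] , [] ∷ []) (v-unsplit ∷ []) , x∈⁅x⁆ x , y∉⁅x⁆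
    where
    y∉⁅x⁆ : y ∉ ⁅ x ⁆
    y∉⁅x⁆ y∈ = x≢y (sym (x∈⁅y⁆⇒x≡y x y∈))
    v-unsplit : EdgeUnsplit e ⁅ x ⁆
    v-unsplit = (λ a∈ → contradiction (inj₁ (sym (x∈⁅y⁆⇒x≡y x a∈))) x∉e) , (λ b∈ → contradiction (inj₂ (sym (x∈⁅y⁆⇒x≡y x b∈))) x∉e)

  -- [v] , [v , v ∩ v′] , [v ∩ v′] , [v ∩ v′ , v′] , [v′] is a path of simplices outside the f-sphere
  same-side-connected : ∀ x y → (∀ {T} → x ∈ T → y ∉ T → Splits T i j) →
                        ∀ {v v′} → InSphere e [ v ] → x ∈ v → y ∉ v → InSphere e [ v′ ] → x ∈ v′ → y ∉ v′ →
                        Connected [ v ] [ v′ ]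
  same-side-connected x y splits {v} {v′} v∈e x∈v y∉v v′∈e x∈v′ y∉v′ =
    (out-v , out-vw , inj₁ (here refl ∷ [])) ◅
    (out-vw , out-w , inj₂ (there (here refl) ∷ [])) ◅
    (out-w , out-wv′ , inj₁ (here refl ∷ [])) ◅
    (out-wv′ , out-v′ , inj₂ (there (here refl) ∷ [])) ◅ ε
    where
    w = v ∩ v′
    x∈w : x ∈ w
    x∈w = x∈p∩q⁺ (x∈v , x∈v′)
    y∉w : y ∉ w
    y∉w = y∉v ∘ proj₁ ∘ x∈p∩q⁻ v v′
    v-InBhat = All.head (proj₁ (proj₁ (inSphere⇒unsplitChain v∈e)))
    v′-InBhat = All.head (proj₁ (proj₁ (inSphere⇒unsplitChain v′∈e)))
    v-unsplit = All.head (proj₂ (inSphere⇒unsplitChain v∈e))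
    v′-unsplit = All.head (proj₂ (inSphere⇒unsplitChain v′∈e))
    w-InBhat : InBhat w
    w-InBhat = (x , x∈w) , (y , y∉w)
    w-unsplit : EdgeUnsplit e w
    w-unsplit = ∩-unsplit v v′ v-unsplit v′-unsplit
    out-v : Outside [ v ]
    out-v = splitting⇒outside v∈e (here refl) (splits x∈v y∉v)
    out-vw : Outside (v ∷ w ∷ [])
    out-vw = splitting⇒outside (unsplitChain⇒inSphere (v-InBhat ∷ w-InBhat ∷ [] , (inj₂ (p∩q⊆p v v′) ∷ []) ∷ [] ∷ [])
                                                     (v-unsplit ∷ w-unsplit ∷ []))
                               (here refl) (splits x∈v y∉v)
    out-w : Outside [ w ]
    out-w = splitting⇒outside (unsplitChain⇒inSphere (w-InBhat ∷ [] , [] ∷ []) (w-unsplit ∷ [])) (here refl) (splits x∈w y∉w)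
    out-wv′ : Outside (w ∷ v′ ∷ [])
    out-wv′ = splitting⇒outside (unsplitChain⇒inSphere (w-InBhat ∷ v′-InBhat ∷ [] , (inj₁ (p∩q⊆q v v′) ∷ []) ∷ [] ∷ [])
                                                      (w-unsplit ∷ v′-unsplit ∷ []))
                                (here refl) (splits x∈w y∉w)
    out-v′ : Outside [ v′ ]
    out-v′ = splitting⇒outside v′∈e (here refl) (splits x∈v′ y∉v′)

  -- along a path outside the f-sphere, some member keeps containing i but not j
  OnSideI : List (Subset d) → Set
  OnSideI σ = ∃ λ T → T ∈ˡ σ × i ∈ T × j ∉ T

  onSideI-touch : ∀ {σ τ} → Touch σ τ → OnSideI σ → OnSideI τ
  onSideI-touch (_ , _ , inj₁ σ⊆τ) (T , T∈ , i∈T , j∉T) = T , All.lookup σ⊆τ T∈ , i∈T , j∉T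
  onSideI-touch ((σ∈e , _) , (τ∈e , τ∉f) , inj₂ τ⊆σ) (T , T∈ , i∈T , j∉T) with splitting-member τ∈e τ∉f
  ... | T′ , T′∈ , inj₁ (i∈T′ , j∉T′) = T′ , T′∈ , i∈T′ , j∉T′
  ... | T′ , T′∈ , inj₂ (j∈T′ , i∉T′) with comparable-∈ (proj₂ (proj₁ (inSphere⇒unsplitChain σ∈e))) T∈ (All.lookup τ⊆σ T′∈)
  ...   | inj₁ T⊆T′ = contradiction (T⊆T′ i∈T) i∉T′
  ...   | inj₂ T′⊆T = contradiction (T′⊆T j∈T′) j∉T

  onSideI-connected : ∀ {σ τ} → Connected σ τ → OnSideI σ → OnSideI τ
  onSideI-connected ε                 = id
  onSideI-connected (touch ◅ touches) = onSideI-connected touches ∘ onSideI-touch touch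

  separates : Separates
  separates =
    (let v , v∈e , i∈v , j∉v = vertex i j (ei≢ej f) (¬sameEdge⇒¬inEdge e f e≠f) in v , v∈e , i∈v , j∉v) ,
    (let v , v∈e , j∈v , i∉v = vertex j i (ei≢ej f ∘ sym) (¬sameEdge⇒¬inEdge e f e≠f ∘ Product.swap) in v , v∈e , j∈v , i∉v) ,
    (λ v v′ (v∈e , i∈v , j∉v) (v′∈e , i∈v′ , j∉v′) → same-side-connected i j (λ i∈ j∉ → inj₁ (i∈ , j∉)) v∈e i∈v j∉v v′∈e i∈v′ j∉v′) ,
    (λ w w′ (w∈e , j∈w , i∉w) (w′∈e , j∈w′ , i∉w′) → same-side-connected j i (λ j∈ i∉ → inj₂ (j∈ , i∉)) w∈e j∈w i∉w w′∈e j∈w′ i∉w′) ,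
    (λ v w (_ , i∈v , j∉v) (_ , j∈w , _) v~w →
      let T , T∈[w] , _ , j∉T = onSideI-connected v~w (v , here refl , i∈v , j∉v) in j∉T (subst (j ∈_) (sym (singleton T∈[w])) j∈w)) ,
    outside-connected
    where
    singleton : ∀ {T w : Subset d} → T ∈ˡ [ w ] → T ≡ w
    singleton (here T≡w) = T≡w
    outside-connected : ∀ σ → Outside σ → (∃ λ v → SideI v × Connected σ [ v ]) ⊎ (∃ λ w → SideJ w × Connected σ [ w ])
    outside-connected σ σ-out@(σ∈e , σ∉f) with splitting-member σ∈e σ∉f
    ... | T , T∈ , inj₁ (i∈T , j∉T) = inj₁ (T , (inSphere-⊆ {e = e} σ∈e (T∈ ∷ []) , i∈T , j∉T) ,
            (σ-out , splitting⇒outside (inSphere-⊆ {e = e} σ∈e (T∈ ∷ [])) (here refl) (inj₁ (i∈T , j∉T)) , inj₂ (T∈ ∷ [])) ◅ ε)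
    ... | T , T∈ , inj₂ (j∈T , i∉T) = inj₂ (T , (inSphere-⊆ {e = e} σ∈e (T∈ ∷ []) , j∈T , i∉T) ,
            (σ-out , splitting⇒outside (inSphere-⊆ {e = e} σ∈e (T∈ ∷ [])) (here refl) (inj₂ (j∈T , i∉T)) , inj₂ (T∈ ∷ [])) ◅ ε)

module _ {m : ℕ} {G : SimpleGraph (suc m)} where

  sphereIso : (e : Edge G) → SimplicialIso (InSphere e) (OCFace m)
  sphereIso e = iso
    where
    open EdgeSphere e using (inSphere⇒unsplitChain; unsplitChain⇒inSphere)
    open Collapse (ei e) (ej e) (ei≢ej e) using (φ; ψ; φψ; unsplit⇒saturated; preimage-unsplit)
    open SaturatedChainIso (InSphere e) (EdgeUnsplit e) inSphere⇒unsplitChain unsplitChain⇒inSphere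
                           φ ψ φψ unsplit⇒saturated preimage-unsplit

module _ {m : ℕ} {G : SimpleGraph (suc (suc m))} where

  intersectionIso : (e f : Edge G) → ¬ SameEdge e f →
                    SimplicialIso (λ σ → InSphere e σ × InSphere f σ) (OCFace m)
  intersectionIso e f e≠f = iso
    where
    module E = EdgeSphere e
    module F = EdgeSphere f
    module C₁ = Collapse (ei e) (ej e) (ei≢ej e)
    a′≢b′ : C₁.φ (ei f) ≢ C₁.φ (ej f)
    a′≢b′ φi≡φj with C₁.φ-identifies φi≡φj
    ... | inj₁ i≡j               = ei≢ej f i≡j
    ... | inj₂ (inj₁ (i≡b , j≡a)) = ¬sameEdge⇒¬inEdge e f e≠f (inj₂ i≡b , inj₁ j≡a)
    ... | inj₂ (inj₂ (i≡a , j≡b)) = ¬sameEdge⇒¬inEdge e f e≠f (inj₁ i≡a , inj₂ j≡b)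
    module C₂ = Collapse (C₁.φ (ei f)) (C₁.φ (ej f)) a′≢b′

    Unsplitₑ₊f : Subset (suc (suc m)) → Set
    Unsplitₑ₊f S = EdgeUnsplit e S × EdgeUnsplit f S

    K⇒ : ∀ {σ} → InSphere e σ × InSphere f σ → OCFace (suc (suc m)) σ × All Unsplitₑ₊f σ
    K⇒ (σ∈e , σ∈f) = proj₁ (E.inSphere⇒unsplitChain σ∈e) ,
                     All.zip (proj₂ (E.inSphere⇒unsplitChain σ∈e) , proj₂ (F.inSphere⇒unsplitChain σ∈f))

    K⇐ : ∀ {σ} → OCFace (suc (suc m)) σ → All Unsplitₑ₊f σ → InSphere e σ × InSphere f σ
    K⇐ σ-face σ-unsplit = E.unsplitChain⇒inSphere σ-face (All.map proj₁ σ-unsplit) ,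
                          F.unsplitChain⇒inSphere σ-face (All.map proj₂ σ-unsplit)

    φ : Fin (suc (suc m)) → Fin m
    φ = C₂.φ ∘ C₁.φ

    ψ : Fin m → Fin (suc (suc m))
    ψ = C₁.ψ ∘ C₂.ψ

    φψ : ∀ c → φ (ψ c) ≡ c
    φψ c = trans (cong C₂.φ (C₁.φψ (C₂.ψ c))) (C₂.φψ c)

    unsplit⇒saturated : ∀ {S} → Unsplitₑ₊f S → Saturated φ ψ S
    unsplit⇒saturated (S-unsplitₑ , S-unsplit_f) =
      saturated-∘ {φ₁ = C₁.φ} {C₁.ψ} {C₂.φ} {C₂.ψ} (C₁.unsplit⇒saturated S-unsplitₑ)
        (C₂.unsplit⇒saturated (saturated⇒unsplit-image {φ = C₁.φ} {C₁.ψ} (C₁.unsplit⇒saturated S-unsplitₑ) S-unsplit_f))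

    preimage-unsplit : ∀ W → Unsplitₑ₊f (preimage φ W)
    preimage-unsplit W = subst Unsplitₑ₊f (sym (preimage-∘ C₁.φ C₂.φ W))
      (C₁.preimage-unsplit (preimage C₂.φ W) , unsplit-preimage C₁.φ (C₂.preimage-unsplit W))

    open SaturatedChainIso (λ σ → InSphere e σ × InSphere f σ) Unsplitₑ₊f K⇒ K⇐ φ ψ φψ unsplit⇒saturated preimage-unsplit

module _ {d′ : ℕ} {G : SimpleGraph (suc d′)} where

  facetOf-face : (e : Edge G) → ∀ {w} → EPerm e w → Face G (facetOf w)
  facetOf-face e {w} p = inSphere⇒face e (w , p , ⊆ˡ-refl (facetOf w))

  facetOf-isFacet : (e : Edge G) → ∀ w → EPerm e w → IsFacet G (facetOf w)
  facetOf-isFacet e w p = facetOf-face e p , maximal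
    where
    open EdgeSphere e using (facet-splits; ∈-facet)
    maximal : ∀ τ → Face G τ → facetOf w ⊆ˡ τ → τ ⊆ˡ facetOf w
    maximal τ τ-face@((τ-InBhat , τ-chain) , _) facet⊆τ with face⇒unsplitEdge τ-face
    ... | f , τ-unsplit with sameEdge? e f
    ...   | no e≠f = let T , T∈ , splits = facet-splits p (ei≢ej f) (¬sameEdge⇒¬inEdge e f e≠f)
                     in contradiction splits (unsplit⇒¬splits (All.lookup τ-unsplit (All.lookup facet⊆τ T∈)))
    ...   | yes (a≡ , b≡) = All.tabulate λ S∈ →
            ∈-facet p (All.lookup τ-InBhat S∈) (subst₂ (Unsplit _) (sym a≡) (sym b≡) (All.lookup τ-unsplit S∈))
                    (λ T∈ → comparable-∈ τ-chain (All.lookup facet⊆τ T∈) S∈)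

  facet⇒facetOf : ∀ σ → IsFacet G σ → Σ (Edge G) λ e → ∃ λ w → EPerm e w × σ ≋ facetOf w
  facet⇒facetOf σ (σ-face , σ-maximal) with face⇒inSphere σ-face
  ... | e , w , p , σ⊆facet = e , w , p , σ⊆facet , σ-maximal (facetOf w) (facetOf-face e p) σ⊆facet

  facetOf-disjoint : ∀ (e f : Edge G) w w′ → EPerm e w → EPerm f w′ → facetOf w ≋ facetOf w′ → SameEdge e f
  facetOf-disjoint e f w w′ p p′ (facet⊆facet′ , _) with sameEdge? e f
  ... | yes e≡f = e≡f
  ... | no e≠f  = let T , T∈ , splits = EdgeSphere.facet-splits e p (ei≢ej f) (¬sameEdge⇒¬inEdge e f e≠f)
                  in contradiction splits (unsplit⇒¬splits (All.lookup (EdgeSphere.facet-unsplit f p′) (All.lookup facet⊆facet′ T∈)))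


module _ {k : ℕ} (G : SimpleGraph (suc (suc (suc k)))) where

  dimension : Edge G → HasDimension G k
  dimension e = (facetOf (letters e) , facetOf-face e ↭-refl , EdgeSphere.facet-unique e ↭-refl ,
                 EdgeSphere.facet-length e ↭-refl) , bounded
    where
    bounded : ∀ σ → Face G σ → Unique σ → length σ ≤ suc k
    bounded σ σ-face σ! =
      let f , w , p , σ⊆facet = face⇒inSphere σ-face
      in ℕₚ.≤-trans {length σ} {length (facetOf w)} (unique⇒length≤ (Vecₚ.≡-dec Bool._≟_) σ (facetOf w) σ! σ⊆facet)
                    (ℕₚ.≤-reflexive (EdgeSphere.facet-length f p))

  part1 : Part1 G
  part1 = (λ e → facetOf-isFacet e , λ _ _ → EdgeSphere.facetOf-injective e) ,
          facet⇒facetOf ,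
          facetOf-disjoint ,
          sphereIso ,
          dimension ,
          (λ noEdge σ σ-face → noEdge (proj₁ (face⇒unsplitEdge σ-face)))

  part2 : Part2 G
  part2 e f e≠f = intersectionIso e f e≠f , Separating.separates e f e≠f

theorem3p4 : (d : ℕ) → 3 ≤ d → (G : SimpleGraph d) → Part1 G × Part2 G
theorem3p4 (suc (suc (suc k))) (s≤s (s≤s (s≤s z≤n))) G = part1 G , part2 G
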